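{- Let $L$ be one of the calculi $\mathrm{gTK}$, $\mathrm{gTKT}$, or $\mathrm{HTS5}$ defined in the context. Then $L$ has the subformula property: if a sequent (for HTS5, a hypersequent) $S$ is provable in $L$, then there is a proof $P$ of $S$ in $L$ such that every formula appearing in $P$ is a subformula of some formula in $S$.
   Context: Formulas are built from countably many propositional variables using the binary connectives $\wedge,\vee,\to$ and the unary connectives $\neg,\Box,\Diamond$; subformulas are defined as usual. Letters $\Gamma,\Delta,\Sigma,\Pi$ (possibly with subscripts) denote finite, possibly empty, sets of formulas; a sequent is an expression $\Gamma\Rightarrow\Delta$; a comma denotes union. For a word $w$ over $\{\neg,\Box,\Diamond\}$, $w\Gamma=\{w\gamma:\gamma\in\Gamma\}$. A rule "$S_1;\dots;S_n\,/\,S$" has premises $S_1,\dots,S_n$ and conclusion $S$. gTK. Initial sequents: for every propositional variable $p$: $p\Rightarrow p$, $\neg p\Rightarrow\neg p$, $\neg p,p\Rightarrow$, $\Rightarrow\neg p,p$. Rules: (cut) $\Gamma\Rightarrow\alpha$; $\alpha,\Gamma\Rightarrow\Delta$ / $\Gamma\Rightarrow\Delta$. (we-left) $\Gamma\Rightarrow\Delta$ / $\alpha,\Gamma\Rightarrow\Delta$. (we-right) $\Gamma\Rightarrow\Delta$ / $\Gamma\Rightarrow\Delta,\alpha$. ($\wedge$left) $\alpha,\beta,\Gamma\Rightarrow\Delta$ / $\alpha\wedge\beta,\Gamma\Rightarrow\Delta$. ($\wedge$right) $\Gamma\Rightarrow\Delta,\alpha$; $\Gamma\Rightarrow\Delta,\beta$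 / $\Gamma\Rightarrow\Delta,\alpha\wedge\beta$. ($\vee$left) $\alpha,\Gamma\Rightarrow\Delta$; $\beta,\Gamma\Rightarrow\Delta$ / $\alpha\vee\beta,\Gamma\Rightarrow\Delta$. ($\vee$right) $\Gamma\Rightarrow\Delta,\alpha,\beta$ / $\Gamma\Rightarrow\Delta,\alpha\vee\beta$. ($\to$left) $\Gamma\Rightarrow\Delta,\alpha$; $\beta,\Gamma\Rightarrow\Delta$ / $\alpha\to\beta,\Gamma\Rightarrow\Delta$. ($\to$right) $\alpha,\Gamma\Rightarrow\Delta,\beta$ / $\Gamma\Rightarrow\Delta,\alpha\to\beta$. ($\neg\neg$left$^t$) $\alpha,\Gamma\Rightarrow\Delta$ / $\neg\neg\alpha,\Gamma\Rightarrow\Delta$. ($\neg\neg$right$^t$) $\Gamma\Rightarrow\Delta,\alpha$ / $\Gamma\Rightarrow\Delta,\neg\neg\alpha$. ($\neg\wedge$left$^t$) $\Gamma\Rightarrow\Delta,\alpha$; $\Gamma\Rightarrow\Delta,\beta$ / $\neg(\alpha\wedge\beta),\Gamma\Rightarrow\Delta$. ($\neg\wedge$right$^t$) $\alpha,\beta,\Gamma\Rightarrow\Delta$ / $\Gamma\Rightarrow\Delta,\neg(\alpha\wedge\beta)$. ($\neg\vee$left$^t$) $\Gamma\Rightarrow\Delta,\alpha,\beta$ / $\neg(\alpha\vee\beta),\Gamma\Rightarrow\Delta$. ($\neg\vee$right$^t$) $\alpha,\Gamma\Rightarrow\Delta$; $\beta,\Gamma\Rightarrow\Delta$ / $\Gamma\Rightarrow\Delta,\neg(\alpha\vee\beta)$.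 ($\neg\to$left$^t$) $\alpha,\Gamma\Rightarrow\Delta,\beta$ / $\neg(\alpha\to\beta),\Gamma\Rightarrow\Delta$. ($\neg\to$right$^t$) $\Gamma\Rightarrow\Delta,\alpha$; $\beta,\Gamma\Rightarrow\Delta$ / $\Gamma\Rightarrow\Delta,\neg(\alpha\to\beta)$. ($\Box$K-right$^T$) $\Gamma_1,\Delta_2\Rightarrow\Delta_1,\Gamma_2,\alpha$ / $\Box\Gamma_1,\neg\Diamond\Gamma_2\Rightarrow\Diamond\Delta_1,\neg\Box\Delta_2,\Box\alpha$. ($\Diamond$K-left$^T$) $\alpha,\Gamma_1,\Delta_2\Rightarrow\Delta_1,\Gamma_2$ / $\Diamond\alpha,\Box\Gamma_1,\neg\Diamond\Gamma_2\Rightarrow\Diamond\Delta_1,\neg\Box\Delta_2$. ($\neg\Box$K-left$^T$) $\Gamma_1,\Delta_2\Rightarrow\Delta_1,\Gamma_2,\alpha$ / $\neg\Box\alpha,\Box\Gamma_1,\neg\Diamond\Gamma_2\Rightarrow\Diamond\Delta_1,\neg\Box\Delta_2$. ($\neg\Diamond$K-right$^T$) $\alpha,\Gamma_1,\Delta_2\Rightarrow\Delta_1,\Gamma_2$ / $\Box\Gamma_1,\neg\Diamond\Gamma_2\Rightarrow\Diamond\Delta_1,\neg\Box\Delta_2,\neg\Diamond\alpha$. gTK has no other rules. gTKT is gTK together with: ($\Box$left) $\alpha,\Gamma\Rightarrow\Delta$ / $\Box\alpha,\Gamma\Rightarrow\Delta$; ($\Diamond$right) $\Gamma\Rightarrow\Delta,\alpha$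 / $\Gamma\Rightarrow\Delta,\Diamond\alpha$; ($\neg\Box$right$^t$) $\alpha,\Gamma\Rightarrow\Delta$ / $\Gamma\Rightarrow\Delta,\neg\Box\alpha$; ($\neg\Diamond$left$^t$) $\Gamma\Rightarrow\Delta,\alpha$ / $\neg\Diamond\alpha,\Gamma\Rightarrow\Delta$. HTS5. A hypersequent is an expression $\Gamma_1\Rightarrow\Delta_1\mid\cdots\mid\Gamma_n\Rightarrow\Delta_n$, regarded as a finite multiset of sequents; $H,G$ range over hypersequents (possibly empty), and $S\mid H$ denotes adding the sequent $S$ to $H$. Initial hypersequents: for every propositional variable $p$: $p\Rightarrow p$, $\neg p\Rightarrow\neg p$, $p,\neg p\Rightarrow$, $\Rightarrow p,\neg p$. Structural rules: (cut) $\Gamma\Rightarrow\Delta,\alpha\mid H$; $\alpha,\Sigma\Rightarrow\Pi\mid G$ / $\Gamma,\Sigma\Rightarrow\Delta,\Pi\mid H\mid G$. (merge) $\Gamma\Rightarrow\Delta\mid\Sigma\Rightarrow\Pi\mid H$ / $\Gamma,\Sigma\Rightarrow\Delta,\Pi\mid H$. (in-we-left) $\Gamma\Rightarrow\Delta\mid H$ / $\alpha,\Gamma\Rightarrow\Delta\mid H$. (in-we-right) $\Gamma\Rightarrow\Delta\mid H$ / $\Gamma\Rightarrow\Delta,\alpha\mid H$. (ex-we-left) $H$ / $\alpha\Rightarrow\ \mid H$. (ex-we-right) $H$ / $\Rightarrow\alpha\mid H$. Non-twist logical rules: ($\wedge$left) $\alpha,\beta,\Gamma\Rightarrow\Delta\mid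 H$ / $\alpha\wedge\beta,\Gamma\Rightarrow\Delta\mid H$. ($\wedge$right) $\Gamma\Rightarrow\Delta,\alpha\mid H$; $\Gamma\Rightarrow\Delta,\beta\mid G$ / $\Gamma\Rightarrow\Delta,\alpha\wedge\beta\mid H\mid G$. ($\vee$left) $\alpha,\Gamma\Rightarrow\Delta\mid H$; $\beta,\Gamma\Rightarrow\Delta\mid G$ / $\alpha\vee\beta,\Gamma\Rightarrow\Delta\mid H\mid G$. ($\vee$right) $\Gamma\Rightarrow\Delta,\alpha,\beta\mid H$ / $\Gamma\Rightarrow\Delta,\alpha\vee\beta\mid H$. ($\to$left) $\Gamma\Rightarrow\Delta,\alpha\mid H$; $\beta,\Gamma\Rightarrow\Delta\mid G$ / $\alpha\to\beta,\Gamma\Rightarrow\Delta\mid H\mid G$. ($\to$right) $\alpha,\Gamma\Rightarrow\Delta,\beta\mid H$ / $\Gamma\Rightarrow\Delta,\alpha\to\beta\mid H$. ($\Box$left) $\alpha,\Gamma\Rightarrow\Delta\mid H$ / $\Box\alpha\Rightarrow\ \mid\Gamma\Rightarrow\Delta\mid H$. ($\Box$right) $\Rightarrow\alpha\mid H$ / $\Rightarrow\Box\alpha\mid H$. ($\Diamond$left) $\alpha\Rightarrow\ \mid H$ / $\Diamond\alpha\Rightarrow\ \mid H$. ($\Diamond$right) $\Gamma\Rightarrow\Delta,\alpha\mid H$ / $\Gamma\Rightarrow\Delta\mid\ \Rightarrow\Diamond\alpha\mid H$. Twist rules: ($\neg\neg$left) $\alpha,\Gamma\Rightarrow\Delta\mid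 H$ / $\neg\neg\alpha,\Gamma\Rightarrow\Delta\mid H$. ($\neg\neg$right) $\Gamma\Rightarrow\Delta,\alpha\mid H$ / $\Gamma\Rightarrow\Delta,\neg\neg\alpha\mid H$. ($\neg\wedge$left) $\Gamma\Rightarrow\Delta,\alpha\mid H$; $\Gamma\Rightarrow\Delta,\beta\mid G$ / $\neg(\alpha\wedge\beta),\Gamma\Rightarrow\Delta\mid H\mid G$. ($\neg\wedge$right) $\alpha,\beta,\Gamma\Rightarrow\Delta\mid H$ / $\Gamma\Rightarrow\Delta,\neg(\alpha\wedge\beta)\mid H$. ($\neg\vee$left) $\Gamma\Rightarrow\Delta,\alpha,\beta\mid H$ / $\neg(\alpha\vee\beta),\Gamma\Rightarrow\Delta\mid H$. ($\neg\vee$right) $\alpha,\Gamma\Rightarrow\Delta\mid H$; $\beta,\Gamma\Rightarrow\Delta\mid G$ / $\Gamma\Rightarrow\Delta,\neg(\alpha\vee\beta)\mid H\mid G$. ($\neg\to$left) $\alpha,\Gamma\Rightarrow\Delta,\beta\mid H$ / $\neg(\alpha\to\beta),\Gamma\Rightarrow\Delta\mid H$. ($\neg\to$right) $\Gamma\Rightarrow\Delta,\alpha\mid H$; $\beta,\Gamma\Rightarrow\Delta\mid G$ / $\Gamma\Rightarrow\Delta,\neg(\alpha\to\beta)\mid H\mid G$. ($\neg\Box$S5-left$^h$) $\Rightarrow\alpha\mid H$ / $\neg\Box\alpha\Rightarrow\ \mid H$. ($\neg\Box$S5-right$^h$) $\alpha,\Gamma\Rightarrow\Delta\mid H$ / $\Gamma\Rightarrow\Delta\mid\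 \Rightarrow\neg\Box\alpha\mid H$. ($\neg\Diamond$S5-left$^h$) $\Gamma\Rightarrow\Delta,\alpha\mid H$ / $\neg\Diamond\alpha\Rightarrow\ \mid\Gamma\Rightarrow\Delta\mid H$. ($\neg\Diamond$S5-right$^h$) $\alpha\Rightarrow\ \mid H$ / $\Rightarrow\neg\Diamond\alpha\mid H$. HTS5 has no other rules. -}

module Defs where

open import Data.Nat using (ℕ)
open import Data.Bool using (Bool; true; false)
open import Data.List using (List; []; _∷_; [_]; _++_; map; concatMap)
open import Data.List.Membership.Propositional using (_∈_)
open import Data.List.Relation.Unary.All using (All; []; _∷_)
open import Data.List.Relation.Binary.Subset.Propositional using (_⊆_)
open import Data.List.Relation.Binary.Permutation.Propositional using (_↭_)
open import Data.Product using (Σ; _×_; ∃-syntax)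
open import Relation.Binary.PropositionalEquality using (_≡_)

infixr 8 _∧_
infixr 7 _∨_
infixr 6 _⊃_
infix 9 ¬_ □_ ◇_

data Fm : Set where
  var : ℕ → Fm
  _∧_ _∨_ _⊃_ : Fm → Fm → Fm
  ¬_ □_ ◇_ : Fm → Fm

infix 3 _⊑_
data _⊑_ (α : Fm) : Fm → Set where
  sf-refl : α ⊑ α
  sf-∧l : ∀ {β γ} → α ⊑ β → α ⊑ β ∧ γ
  sf-∧r : ∀ {β γ} → α ⊑ γ → α ⊑ β ∧ γ
  sf-∨l : ∀ {β γ} → α ⊑ β → α ⊑ β ∨ γ
  sf-∨r : ∀ {β γ} → α ⊑ γ → α ⊑ β ∨ γ
  sf-⊃l : ∀ {β γ} → α ⊑ β → α ⊑ β ⊃ γ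
  sf-⊃r : ∀ {β γ} → α ⊑ γ → α ⊑ β ⊃ γ
  sf-¬ : ∀ {β} → α ⊑ β → α ⊑ ¬ β
  sf-□ : ∀ {β} → α ⊑ β → α ⊑ □ β
  sf-◇ : ∀ {β} → α ⊑ β → α ⊑ ◇ β

-- Finite sets of formulas are represented by lists; two lists
-- denote the same set when they are mutually included (_≋_). Every calculus
-- below has a bookkeeping rule allowing one to replace a list by another
-- denoting the same set, so derivability is derivability of set-sequents.

infix 4 _≋_
_≋_ : List Fm → List Fm → Set
Γ ≋ Δ = Γ ⊆ Δ × Δ ⊆ Γ

infix 2 _⇒_
record Seq : Set where
  constructor _⇒_
  field
    ant : List Fm
    suc : List Fm

seqFmls : Seq → List Fm
seqFmls (Γ ⇒ Δ) = Γ ++ Δ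

-- Hypersequents: finite multisets (lists up to permutation) of sequents
HSeq : Set
HSeq = List Seq

hseqFmls : HSeq → List Fm
hseqFmls = concatMap seqFmls

data Deriv {J : Set} (R : List J → J → Set) : J → Set where
  node : ∀ {ps c} → R ps c → All (Deriv R) ps → Deriv R c

mutual
  nodes : ∀ {J} {R : List J → J → Set} {c} → Deriv R c → List J
  nodes (node {c = c} _ ds) = c ∷ nodesAll ds

  nodesAll : ∀ {J} {R : List J → J → Set} {ps} → All (Deriv R) ps → List J
  nodesAll [] = []
  nodesAll (d ∷ ds) = nodes d ++ nodesAll ds

SubformulaProperty : {J : Set} → (R : List J → J → Set) → (J → List Fm) → Set
SubformulaProperty R fm =
  ∀ S → Deriv R S →
  Σ (Deriv R S) λ P →
    ∀ φ → φ ∈ concatMap fm (nodes P) → ∃[ ψ ] (ψ ∈ fm S × φ ⊑ ψ)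

-- gTK (T = false) and gTKT (T = true)

data GK (T : Bool) : List Seq → Seq → Set where
  set-eq : ∀ {Γ Γ' Δ Δ'} → Γ ≋ Γ' → Δ ≋ Δ' → GK T [ Γ ⇒ Δ ] (Γ' ⇒ Δ')
  init-1 : ∀ p → GK T [] ([ var p ] ⇒ [ var p ])
  init-2 : ∀ p → GK T [] ([ ¬ var p ] ⇒ [ ¬ var p ])
  init-3 : ∀ p → GK T [] (¬ var p ∷ var p ∷ [] ⇒ [])
  init-4 : ∀ p → GK T [] ([] ⇒ ¬ var p ∷ var p ∷ [])
  cut : ∀ {Γ Δ α} → GK T ((Γ ⇒ [ α ]) ∷ (α ∷ Γ ⇒ Δ) ∷ []) (Γ ⇒ Δ)
  we-left : ∀ {Γ Δ α} → GK T [ Γ ⇒ Δ ] (α ∷ Γ ⇒ Δ)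
  we-right : ∀ {Γ Δ α} → GK T [ Γ ⇒ Δ ] (Γ ⇒ α ∷ Δ)
  ∧left : ∀ {Γ Δ α β} → GK T [ α ∷ β ∷ Γ ⇒ Δ ] (α ∧ β ∷ Γ ⇒ Δ)
  ∧right : ∀ {Γ Δ α β} → GK T ((Γ ⇒ α ∷ Δ) ∷ (Γ ⇒ β ∷ Δ) ∷ []) (Γ ⇒ α ∧ β ∷ Δ)
  ∨left : ∀ {Γ Δ α β} → GK T ((α ∷ Γ ⇒ Δ) ∷ (β ∷ Γ ⇒ Δ) ∷ []) (α ∨ β ∷ Γ ⇒ Δ)
  ∨right : ∀ {Γ Δ α β} → GK T [ Γ ⇒ α ∷ β ∷ Δ ] (Γ ⇒ α ∨ β ∷ Δ)
  ⊃left : ∀ {Γ Δ α β} → GK T ((Γ ⇒ α ∷ Δ) ∷ (β ∷ Γ ⇒ Δ) ∷ []) (α ⊃ β ∷ Γ ⇒ Δ)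
  ⊃right : ∀ {Γ Δ α β} → GK T [ α ∷ Γ ⇒ β ∷ Δ ] (Γ ⇒ α ⊃ β ∷ Δ)
  ¬¬left : ∀ {Γ Δ α} → GK T [ α ∷ Γ ⇒ Δ ] (¬ ¬ α ∷ Γ ⇒ Δ)
  ¬¬right : ∀ {Γ Δ α} → GK T [ Γ ⇒ α ∷ Δ ] (Γ ⇒ ¬ ¬ α ∷ Δ)
  ¬∧left : ∀ {Γ Δ α β} → GK T ((Γ ⇒ α ∷ Δ) ∷ (Γ ⇒ β ∷ Δ) ∷ []) (¬ (α ∧ β) ∷ Γ ⇒ Δ)
  ¬∧right : ∀ {Γ Δ α β} → GK T [ α ∷ β ∷ Γ ⇒ Δ ] (Γ ⇒ ¬ (α ∧ β) ∷ Δ)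
  ¬∨left : ∀ {Γ Δ α β} → GK T [ Γ ⇒ α ∷ β ∷ Δ ] (¬ (α ∨ β) ∷ Γ ⇒ Δ)
  ¬∨right : ∀ {Γ Δ α β} → GK T ((α ∷ Γ ⇒ Δ) ∷ (β ∷ Γ ⇒ Δ) ∷ []) (Γ ⇒ ¬ (α ∨ β) ∷ Δ)
  ¬⊃left : ∀ {Γ Δ α β} → GK T [ α ∷ Γ ⇒ β ∷ Δ ] (¬ (α ⊃ β) ∷ Γ ⇒ Δ)
  ¬⊃right : ∀ {Γ Δ α β} → GK T ((Γ ⇒ α ∷ Δ) ∷ (β ∷ Γ ⇒ Δ) ∷ []) (Γ ⇒ ¬ (α ⊃ β) ∷ Δ)
  □K-right : ∀ {Γ₁ Γ₂ Δ₁ Δ₂ α} →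
    GK T [ (Γ₁ ++ Δ₂ ⇒ Δ₁ ++ Γ₂ ++ [ α ]) ]
         (map □_ Γ₁ ++ map (λ x → ¬ ◇ x) Γ₂ ⇒ map ◇_ Δ₁ ++ map (λ x → ¬ □ x) Δ₂ ++ [ □ α ])
  ◇K-left : ∀ {Γ₁ Γ₂ Δ₁ Δ₂ α} →
    GK T [ α ∷ Γ₁ ++ Δ₂ ⇒ Δ₁ ++ Γ₂ ]
         (◇ α ∷ map □_ Γ₁ ++ map (λ x → ¬ ◇ x) Γ₂ ⇒ map ◇_ Δ₁ ++ map (λ x → ¬ □ x) Δ₂)
  ¬□K-left : ∀ {Γ₁ Γ₂ Δ₁ Δ₂ α} →
    GK T [ (Γ₁ ++ Δ₂ ⇒ Δ₁ ++ Γ₂ ++ [ α ]) ]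
         (¬ □ α ∷ map □_ Γ₁ ++ map (λ x → ¬ ◇ x) Γ₂ ⇒ map ◇_ Δ₁ ++ map (λ x → ¬ □ x) Δ₂)
  ¬◇K-right : ∀ {Γ₁ Γ₂ Δ₁ Δ₂ α} →
    GK T [ α ∷ Γ₁ ++ Δ₂ ⇒ Δ₁ ++ Γ₂ ]
         (map □_ Γ₁ ++ map (λ x → ¬ ◇ x) Γ₂ ⇒ map ◇_ Δ₁ ++ map (λ x → ¬ □ x) Δ₂ ++ [ ¬ ◇ α ])
  □left : ∀ {Γ Δ α} → T ≡ true → GK T [ α ∷ Γ ⇒ Δ ] (□ α ∷ Γ ⇒ Δ)
  ◇right : ∀ {Γ Δ α} → T ≡ true → GK T [ Γ ⇒ α ∷ Δ ] (Γ ⇒ ◇ α ∷ Δ)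
  ¬□right : ∀ {Γ Δ α} → T ≡ true → GK T [ α ∷ Γ ⇒ Δ ] (Γ ⇒ ¬ □ α ∷ Δ)
  ¬◇left : ∀ {Γ Δ α} → T ≡ true → GK T [ Γ ⇒ α ∷ Δ ] (¬ ◇ α ∷ Γ ⇒ Δ)

gTK : List Seq → Seq → Set
gTK = GK false

gTKT : List Seq → Seq → Set
gTKT = GK true

data HTS5 : List HSeq → HSeq → Set where
  perm : ∀ {H H'} → H ↭ H' → HTS5 [ H ] H'
  comp-eq : ∀ {Γ Γ' Δ Δ' H} → Γ ≋ Γ' → Δ ≋ Δ' → HTS5 [ (Γ ⇒ Δ) ∷ H ] ((Γ' ⇒ Δ') ∷ H)
  init-1 : ∀ p → HTS5 [] [ [ var p ] ⇒ [ var p ] ]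
  init-2 : ∀ p → HTS5 [] [ [ ¬ var p ] ⇒ [ ¬ var p ] ]
  init-3 : ∀ p → HTS5 [] [ var p ∷ ¬ var p ∷ [] ⇒ [] ]
  init-4 : ∀ p → HTS5 [] [ [] ⇒ var p ∷ ¬ var p ∷ [] ]
  cut : ∀ {Γ Δ Σ Π α H G} →
    HTS5 (((Γ ⇒ α ∷ Δ) ∷ H) ∷ ((α ∷ Σ ⇒ Π) ∷ G) ∷ []) ((Γ ++ Σ ⇒ Δ ++ Π) ∷ H ++ G)
  merge : ∀ {Γ Δ Σ Π H} → HTS5 [ (Γ ⇒ Δ) ∷ (Σ ⇒ Π) ∷ H ] ((Γ ++ Σ ⇒ Δ ++ Π) ∷ H)
  in-we-left : ∀ {Γ Δ α H} → HTS5 [ (Γ ⇒ Δ) ∷ H ] ((α ∷ Γ ⇒ Δ) ∷ H)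
  in-we-right : ∀ {Γ Δ α H} → HTS5 [ (Γ ⇒ Δ) ∷ H ] ((Γ ⇒ α ∷ Δ) ∷ H)
  ex-we-left : ∀ {α H} → HTS5 [ H ] (([ α ] ⇒ []) ∷ H)
  ex-we-right : ∀ {α H} → HTS5 [ H ] (([] ⇒ [ α ]) ∷ H)
  ∧left : ∀ {Γ Δ α β H} → HTS5 [ (α ∷ β ∷ Γ ⇒ Δ) ∷ H ] ((α ∧ β ∷ Γ ⇒ Δ) ∷ H)
  ∧right : ∀ {Γ Δ α β H G} →
    HTS5 (((Γ ⇒ α ∷ Δ) ∷ H) ∷ ((Γ ⇒ β ∷ Δ) ∷ G) ∷ []) ((Γ ⇒ α ∧ β ∷ Δ) ∷ H ++ G)
  ∨left : ∀ {Γ Δ α β H G} →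
    HTS5 (((α ∷ Γ ⇒ Δ) ∷ H) ∷ ((β ∷ Γ ⇒ Δ) ∷ G) ∷ []) ((α ∨ β ∷ Γ ⇒ Δ) ∷ H ++ G)
  ∨right : ∀ {Γ Δ α β H} → HTS5 [ (Γ ⇒ α ∷ β ∷ Δ) ∷ H ] ((Γ ⇒ α ∨ β ∷ Δ) ∷ H)
  ⊃left : ∀ {Γ Δ α β H G} →
    HTS5 (((Γ ⇒ α ∷ Δ) ∷ H) ∷ ((β ∷ Γ ⇒ Δ) ∷ G) ∷ []) ((α ⊃ β ∷ Γ ⇒ Δ) ∷ H ++ G)
  ⊃right : ∀ {Γ Δ α β H} → HTS5 [ (α ∷ Γ ⇒ β ∷ Δ) ∷ H ] ((Γ ⇒ α ⊃ β ∷ Δ) ∷ H)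
  □left : ∀ {Γ Δ α H} → HTS5 [ (α ∷ Γ ⇒ Δ) ∷ H ] (([ □ α ] ⇒ []) ∷ (Γ ⇒ Δ) ∷ H)
  □right : ∀ {α H} → HTS5 [ ([] ⇒ [ α ]) ∷ H ] (([] ⇒ [ □ α ]) ∷ H)
  ◇left : ∀ {α H} → HTS5 [ ([ α ] ⇒ []) ∷ H ] (([ ◇ α ] ⇒ []) ∷ H)
  ◇right : ∀ {Γ Δ α H} → HTS5 [ (Γ ⇒ α ∷ Δ) ∷ H ] ((Γ ⇒ Δ) ∷ ([] ⇒ [ ◇ α ]) ∷ H)
  ¬¬left : ∀ {Γ Δ α H} → HTS5 [ (α ∷ Γ ⇒ Δ) ∷ H ] ((¬ ¬ α ∷ Γ ⇒ Δ) ∷ H)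
  ¬¬right : ∀ {Γ Δ α H} → HTS5 [ (Γ ⇒ α ∷ Δ) ∷ H ] ((Γ ⇒ ¬ ¬ α ∷ Δ) ∷ H)
  ¬∧left : ∀ {Γ Δ α β H G} →
    HTS5 (((Γ ⇒ α ∷ Δ) ∷ H) ∷ ((Γ ⇒ β ∷ Δ) ∷ G) ∷ []) ((¬ (α ∧ β) ∷ Γ ⇒ Δ) ∷ H ++ G)
  ¬∧right : ∀ {Γ Δ α β H} → HTS5 [ (α ∷ β ∷ Γ ⇒ Δ) ∷ H ] ((Γ ⇒ ¬ (α ∧ β) ∷ Δ) ∷ H)
  ¬∨left : ∀ {Γ Δ α β H} → HTS5 [ (Γ ⇒ α ∷ β ∷ Δ) ∷ H ] ((¬ (α ∨ β) ∷ Γ ⇒ Δ) ∷ H)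
  ¬∨right : ∀ {Γ Δ α β H G} →
    HTS5 (((α ∷ Γ ⇒ Δ) ∷ H) ∷ ((β ∷ Γ ⇒ Δ) ∷ G) ∷ []) ((Γ ⇒ ¬ (α ∨ β) ∷ Δ) ∷ H ++ G)
  ¬⊃left : ∀ {Γ Δ α β H} → HTS5 [ (α ∷ Γ ⇒ β ∷ Δ) ∷ H ] ((¬ (α ⊃ β) ∷ Γ ⇒ Δ) ∷ H)
  ¬⊃right : ∀ {Γ Δ α β H G} →
    HTS5 (((Γ ⇒ α ∷ Δ) ∷ H) ∷ ((β ∷ Γ ⇒ Δ) ∷ G) ∷ []) ((Γ ⇒ ¬ (α ⊃ β) ∷ Δ) ∷ H ++ G)
  ¬□S5-left : ∀ {α H} → HTS5 [ ([] ⇒ [ α ]) ∷ H ] (([ ¬ □ α ] ⇒ []) ∷ H)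
  ¬□S5-right : ∀ {Γ Δ α H} → HTS5 [ (α ∷ Γ ⇒ Δ) ∷ H ] ((Γ ⇒ Δ) ∷ ([] ⇒ [ ¬ □ α ]) ∷ H)
  ¬◇S5-left : ∀ {Γ Δ α H} → HTS5 [ (Γ ⇒ α ∷ Δ) ∷ H ] (([ ¬ ◇ α ] ⇒ []) ∷ (Γ ⇒ Δ) ∷ H)
  ¬◇S5-right : ∀ {α H} → HTS5 [ ([ α ] ⇒ []) ∷ H ] (([] ⇒ [ ¬ ◇ α ]) ∷ H)

-- Backward proof search that only ever adds subformulas of the end-sequent either yields a
-- derivation built from such subformulas or gets stuck on a saturated, non-axiomatic branch. The
-- propositional and T-rules are applied until every formula is saturated (one premise of its rule is
-- already contained in the sequent); since the sequent only grows inside the finite set of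
-- subformulas, this terminates. For gTK and gTKT the K-rules then recurse on strictly smaller
-- formulas, and the refuted premises become the successors of a finite tree model (reflexive for
-- gTKT) refuting the sequent. For HTS5 the modal rules instead propagate formulas across components or
-- create new witness components, and a saturated hypersequent is refuted by the S5 model with one
-- world per component. By soundness a derivable (hyper)sequent has no countermodel, so the search
-- returns an analytic derivation.

module Submission where

open import Data.Bool using (Bool; true; false; not) renaming (_∧_ to _&&_; _∨_ to _||_)
open import Data.Bool.ListAction using (all; any)
open import Data.Empty using (⊥; ⊥-elim)
open import Data.List using (List; []; _∷_; [_]; _++_; map; concatMap)
open import Data.List.Membership.Propositional using (_∈_; _∉_; find; lose)
open import Data.List.Membership.Propositional.Properties
  using (∈-++⁺ˡ; ∈-++⁺ʳ; ∈-++⁻; ∈-map⁺; ∈-map⁻; ∈-concatMap⁺; ∈-concatMap⁻; ∈-∃++)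
open import Data.List.Properties using (++-identityʳ)
open import Data.List.Relation.Binary.Permutation.Propositional using (_↭_; ↭-refl; ↭-sym; ↭-trans; prep; swap)
open import Data.List.Relation.Binary.Permutation.Propositional.Properties using (All-resp-↭; shift; ++-comm)
open import Data.List.Relation.Binary.Subset.Propositional using (_⊆_)
open import Data.List.Relation.Binary.Subset.Propositional.Properties using (All-resp-⊇; ∈-∷⁺ʳ)
import Data.List.Relation.Binary.Subset.Propositional.Properties as Subset
open import Data.List.Relation.Unary.All using (All; []; _∷_; tabulate; all?)
import Data.List.Relation.Unary.All as All
open import Data.List.Relation.Unary.All.Properties using (++⁺; ++⁻; ++⁻ˡ; ++⁻ʳ; map⁺; map⁻; ¬All⇒Any¬)
open import Data.List.Relation.Unary.Any using (Any; here; there; any?)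
import Data.List.Relation.Unary.Any as Any
open import Data.Maybe using (Maybe; just; nothing)
open import Data.Nat using (ℕ; zero; suc; _+_; _≤_; _<_; z≤n; s≤s)
open import Data.Nat.ListAction using (sum)
open import Data.Nat.Properties
  using (≤-refl; ≤-trans; n≮0; <-≤-trans; ≤-<-trans; ≤-pred; m≤m+n; m≤n+m; m≤n⇒m≤1+n; n≤1+n;
         +-mono-≤; +-mono-<-≤; +-mono-≤-<; +-monoˡ-<; +-monoʳ-<)
  renaming (_≟_ to _≟ℕ_)
open import Data.Product using (Σ; _×_; _,_; proj₁; proj₂; ∃-syntax; uncurry)
open import Data.Sum using (_⊎_; inj₁; inj₂)
import Data.Sum as Sum
open import Data.Unit using (⊤; tt)
open import Function using (_∘_; id)
open import Relation.Binary.Definitions using (DecidableEquality)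
open import Relation.Binary.PropositionalEquality using (_≡_; refl; cong; cong₂)
open import Relation.Nullary using (Dec; yes; no; does)
open import Relation.Nullary.Decidable using (map′; _×-dec_; _⊎-dec_; dec-true; dec-false; toSum)

open import Defs

_≟_ : DecidableEquality Fm
var p ≟ var q = map′ (cong var) (λ { refl → refl }) (p ≟ℕ q)
(a ∧ b) ≟ (c ∧ d) = map′ (uncurry (cong₂ _∧_)) (λ { refl → refl , refl }) (a ≟ c ×-dec b ≟ d)
(a ∨ b) ≟ (c ∨ d) = map′ (uncurry (cong₂ _∨_)) (λ { refl → refl , refl }) (a ≟ c ×-dec b ≟ d)
(a ⊃ b) ≟ (c ⊃ d) = map′ (uncurry (cong₂ _⊃_)) (λ { refl → refl , refl }) (a ≟ c ×-dec b ≟ d)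
(¬ a) ≟ (¬ c) = map′ (cong ¬_) (λ { refl → refl }) (a ≟ c)
(□ a) ≟ (□ c) = map′ (cong □_) (λ { refl → refl }) (a ≟ c)
(◇ a) ≟ (◇ c) = map′ (cong ◇_) (λ { refl → refl }) (a ≟ c)
var _ ≟ (_ ∧ _) = no λ ()
var _ ≟ (_ ∨ _) = no λ ()
var _ ≟ (_ ⊃ _) = no λ ()
var _ ≟ (¬ _) = no λ ()
var _ ≟ (□ _) = no λ ()
var _ ≟ (◇ _) = no λ ()
(_ ∧ _) ≟ var _ = no λ ()
(_ ∧ _) ≟ (_ ∨ _) = no λ ()
(_ ∧ _) ≟ (_ ⊃ _) = no λ ()
(_ ∧ _) ≟ (¬ _) = no λ ()
(_ ∧ _) ≟ (□ _) = no λ ()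
(_ ∧ _) ≟ (◇ _) = no λ ()
(_ ∨ _) ≟ var _ = no λ ()
(_ ∨ _) ≟ (_ ∧ _) = no λ ()
(_ ∨ _) ≟ (_ ⊃ _) = no λ ()
(_ ∨ _) ≟ (¬ _) = no λ ()
(_ ∨ _) ≟ (□ _) = no λ ()
(_ ∨ _) ≟ (◇ _) = no λ ()
(_ ⊃ _) ≟ var _ = no λ ()
(_ ⊃ _) ≟ (_ ∧ _) = no λ ()
(_ ⊃ _) ≟ (_ ∨ _) = no λ ()
(_ ⊃ _) ≟ (¬ _) = no λ ()
(_ ⊃ _) ≟ (□ _) = no λ ()
(_ ⊃ _) ≟ (◇ _) = no λ ()
(¬ _) ≟ var _ = no λ ()
(¬ _) ≟ (_ ∧ _) = no λ ()
(¬ _) ≟ (_ ∨ _) = no λ ()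
(¬ _) ≟ (_ ⊃ _) = no λ ()
(¬ _) ≟ (□ _) = no λ ()
(¬ _) ≟ (◇ _) = no λ ()
(□ _) ≟ var _ = no λ ()
(□ _) ≟ (_ ∧ _) = no λ ()
(□ _) ≟ (_ ∨ _) = no λ ()
(□ _) ≟ (_ ⊃ _) = no λ ()
(□ _) ≟ (¬ _) = no λ ()
(□ _) ≟ (◇ _) = no λ ()
(◇ _) ≟ var _ = no λ ()
(◇ _) ≟ (_ ∧ _) = no λ ()
(◇ _) ≟ (_ ∨ _) = no λ ()
(◇ _) ≟ (_ ⊃ _) = no λ ()
(◇ _) ≟ (¬ _) = no λ ()
(◇ _) ≟ (□ _) = no λ ()

open import Data.List.Membership.DecPropositional _≟_ using (_∈?_)
open import Data.List.Relation.Binary.Subset.DecPropositional _≟_ using (_⊆?_)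

infix 7 _∈ᵇ_
_∈ᵇ_ : Fm → List Fm → Bool
x ∈ᵇ L = does (x ∈? L)

∈⇒∈ᵇ : ∀ {x L} → x ∈ L → x ∈ᵇ L ≡ true
∈⇒∈ᵇ {x} {L} = dec-true (x ∈? L)

∉⇒∉ᵇ : ∀ {x L} → x ∉ L → x ∈ᵇ L ≡ false
∉⇒∉ᵇ {x} {L} = dec-false (x ∈? L)

true-and-false : ∀ {b} → b ≡ true → b ≡ false → ⊥
true-and-false refl ()

∧-true⁻ˡ : ∀ {a b} → a && b ≡ true → a ≡ true
∧-true⁻ˡ {true} _ = refl

∧-true⁻ʳ : ∀ {a b} → a && b ≡ true → b ≡ true
∧-true⁻ʳ {true} e = e

∧-true⁺ : ∀ {a b} → a ≡ true → b ≡ true → a && b ≡ true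
∧-true⁺ refl refl = refl

∨-true⁺ : ∀ {a b} → a ≡ true ⊎ b ≡ true → a || b ≡ true
∨-true⁺ {true} _ = refl
∨-true⁺ {false} (inj₂ e) = e

∨-true⁻ : ∀ {a b} → a || b ≡ true → a ≡ true ⊎ b ≡ true
∨-true⁻ {true} _ = inj₁ refl
∨-true⁻ {false} e = inj₂ e

∧-false⁺ : ∀ {a b} → a ≡ false ⊎ b ≡ false → a && b ≡ false
∧-false⁺ {false} _ = refl
∧-false⁺ {true} (inj₂ e) = e

∧-false⁻ : ∀ {a b} → a && b ≡ false → a ≡ false ⊎ b ≡ false
∧-false⁻ {false} _ = inj₁ refl
∧-false⁻ {true} e = inj₂ e

∨-false⁺ : ∀ {a b} → a ≡ false → b ≡ false → a || b ≡ false
∨-false⁺ refl refl = refl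

∨-false⁻ : ∀ {a b} → a || b ≡ false → a ≡ false × b ≡ false
∨-false⁻ {false} e = refl , e

not-true⁺ : ∀ {a} → a ≡ false → not a ≡ true
not-true⁺ refl = refl

not-false⁺ : ∀ {a} → a ≡ true → not a ≡ false
not-false⁺ refl = refl

not-true⁻ : ∀ {a} → not a ≡ true → a ≡ false
not-true⁻ {false} _ = refl

not-false⁻ : ∀ {a} → not a ≡ false → a ≡ true
not-false⁻ {true} _ = refl

guarded-true : ∀ b {x} → (b ≡ true → x ≡ true) → not b || x ≡ true
guarded-true false _ = refl
guarded-true true h = h refl

guarded-false : ∀ b {x} → (b ≡ true → x ≡ false) → b && x ≡ false
guarded-false false _ = refl
guarded-false true h = h refl

≋-refl : ∀ {X : List Fm} → X ≋ X
≋-refl = id , id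

∷-absorb : ∀ {x : Fm} {Y} → x ∈ Y → x ∷ Y ≋ Y
∷-absorb x∈Y = ∈-∷⁺ʳ x∈Y id , there

⊆-absorbˡ : ∀ {X Y : List Fm} → X ⊆ Y → X ++ Y ≋ Y
⊆-absorbˡ {X} X⊆Y = Sum.[ X⊆Y , id ] ∘ ∈-++⁻ X , ∈-++⁺ʳ X

⊆-absorbʳ : ∀ {X Y : List Fm} → X ⊆ Y → Y ++ X ≋ Y
⊆-absorbʳ {Y = Y} X⊆Y = Sum.[ id , X⊆Y ] ∘ ∈-++⁻ Y , ∈-++⁺ˡ

⊑-trans : ∀ {a b c} → a ⊑ b → b ⊑ c → a ⊑ c
⊑-trans p sf-refl = p
⊑-trans p (sf-∧l q) = sf-∧l (⊑-trans p q)
⊑-trans p (sf-∧r q) = sf-∧r (⊑-trans p q)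
⊑-trans p (sf-∨l q) = sf-∨l (⊑-trans p q)
⊑-trans p (sf-∨r q) = sf-∨r (⊑-trans p q)
⊑-trans p (sf-⊃l q) = sf-⊃l (⊑-trans p q)
⊑-trans p (sf-⊃r q) = sf-⊃r (⊑-trans p q)
⊑-trans p (sf-¬ q) = sf-¬ (⊑-trans p q)
⊑-trans p (sf-□ q) = sf-□ (⊑-trans p q)
⊑-trans p (sf-◇ q) = sf-◇ (⊑-trans p q)

infix 3 _⊑*_
_⊑*_ : Fm → List Fm → Set
φ ⊑* X = ∃[ ψ ] (ψ ∈ X × φ ⊑ ψ)

∈⇒⊑* : ∀ {φ X} → φ ∈ X → φ ⊑* X
∈⇒⊑* φ∈X = _ , φ∈X , sf-refl

⊑*-mono : ∀ {φ X Y} → X ⊆ Y → φ ⊑* X → φ ⊑* Y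
⊑*-mono X⊆Y (ψ , ψ∈X , φ⊑ψ) = ψ , X⊆Y ψ∈X , φ⊑ψ

⊑-⊑*-trans : ∀ {φ χ X} → φ ⊑ χ → χ ⊑* X → φ ⊑* X
⊑-⊑*-trans φ⊑χ (ψ , ψ∈X , χ⊑ψ) = ψ , ψ∈X , ⊑-trans φ⊑χ χ⊑ψ

⊑∧ˡ : ∀ {a b} → a ⊑ a ∧ b
⊑∧ˡ = sf-∧l sf-refl

⊑∧ʳ : ∀ {a b} → b ⊑ a ∧ b
⊑∧ʳ = sf-∧r sf-refl

⊑∨ˡ : ∀ {a b} → a ⊑ a ∨ b
⊑∨ˡ = sf-∨l sf-refl

⊑∨ʳ : ∀ {a b} → b ⊑ a ∨ b
⊑∨ʳ = sf-∨r sf-refl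

⊑⊃ˡ : ∀ {a b} → a ⊑ a ⊃ b
⊑⊃ˡ = sf-⊃l sf-refl

⊑⊃ʳ : ∀ {a b} → b ⊑ a ⊃ b
⊑⊃ʳ = sf-⊃r sf-refl

⊑¬ : ∀ {a} → a ⊑ ¬ a
⊑¬ = sf-¬ sf-refl

⊑□ : ∀ {a} → a ⊑ □ a
⊑□ = sf-□ sf-refl

⊑◇ : ∀ {a} → a ⊑ ◇ a
⊑◇ = sf-◇ sf-refl

subformulas : Fm → List Fm
subformulas (var p) = [ var p ]
subformulas (a ∧ b) = (a ∧ b) ∷ subformulas a ++ subformulas b
subformulas (a ∨ b) = (a ∨ b) ∷ subformulas a ++ subformulas b
subformulas (a ⊃ b) = (a ⊃ b) ∷ subformulas a ++ subformulas b
subformulas (¬ a) = (¬ a) ∷ subformulas a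
subformulas (□ a) = (□ a) ∷ subformulas a
subformulas (◇ a) = (◇ a) ∷ subformulas a

⊑⇒∈subformulas : ∀ {a b} → a ⊑ b → a ∈ subformulas b
⊑⇒∈subformulas {b = var _} sf-refl = here refl
⊑⇒∈subformulas {b = _ ∧ _} sf-refl = here refl
⊑⇒∈subformulas {b = _ ∨ _} sf-refl = here refl
⊑⇒∈subformulas {b = _ ⊃ _} sf-refl = here refl
⊑⇒∈subformulas {b = ¬ _} sf-refl = here refl
⊑⇒∈subformulas {b = □ _} sf-refl = here refl
⊑⇒∈subformulas {b = ◇ _} sf-refl = here refl
⊑⇒∈subformulas (sf-∧l p) = there (∈-++⁺ˡ (⊑⇒∈subformulas p))
⊑⇒∈subformulas (sf-∧r {β} p) = there (∈-++⁺ʳ (subformulas β) (⊑⇒∈subformulas p))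
⊑⇒∈subformulas (sf-∨l p) = there (∈-++⁺ˡ (⊑⇒∈subformulas p))
⊑⇒∈subformulas (sf-∨r {β} p) = there (∈-++⁺ʳ (subformulas β) (⊑⇒∈subformulas p))
⊑⇒∈subformulas (sf-⊃l p) = there (∈-++⁺ˡ (⊑⇒∈subformulas p))
⊑⇒∈subformulas (sf-⊃r {β} p) = there (∈-++⁺ʳ (subformulas β) (⊑⇒∈subformulas p))
⊑⇒∈subformulas (sf-¬ p) = there (⊑⇒∈subformulas p)
⊑⇒∈subformulas (sf-□ p) = there (⊑⇒∈subformulas p)
⊑⇒∈subformulas (sf-◇ p) = there (⊑⇒∈subformulas p)

⊑*⇒∈subformulas : ∀ {φ X} → φ ⊑* X → φ ∈ concatMap subformulas X
⊑*⇒∈subformulas (ψ , ψ∈X , φ⊑ψ) = ∈-concatMap⁺ subformulas (Any.map (λ { refl → ⊑⇒∈subformulas φ⊑ψ }) ψ∈X)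

size : Fm → ℕ
size (var _) = 1
size (a ∧ b) = suc (size a + size b)
size (a ∨ b) = suc (size a + size b)
size (a ⊃ b) = suc (size a + size b)
size (¬ a) = suc (size a)
size (□ a) = suc (size a)
size (◇ a) = suc (size a)

⊑⇒size≤ : ∀ {a b} → a ⊑ b → size a ≤ size b
⊑⇒size≤ sf-refl = ≤-refl
⊑⇒size≤ (sf-∧l {β} {γ} p) = ≤-trans (⊑⇒size≤ p) (m≤n⇒m≤1+n (m≤m+n (size β) (size γ)))
⊑⇒size≤ (sf-∧r {β} {γ} p) = ≤-trans (⊑⇒size≤ p) (m≤n⇒m≤1+n (m≤n+m (size γ) (size β)))
⊑⇒size≤ (sf-∨l {β} {γ} p) = ≤-trans (⊑⇒size≤ p) (m≤n⇒m≤1+n (m≤m+n (size β) (size γ)))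
⊑⇒size≤ (sf-∨r {β} {γ} p) = ≤-trans (⊑⇒size≤ p) (m≤n⇒m≤1+n (m≤n+m (size γ) (size β)))
⊑⇒size≤ (sf-⊃l {β} {γ} p) = ≤-trans (⊑⇒size≤ p) (m≤n⇒m≤1+n (m≤m+n (size β) (size γ)))
⊑⇒size≤ (sf-⊃r {β} {γ} p) = ≤-trans (⊑⇒size≤ p) (m≤n⇒m≤1+n (m≤n+m (size γ) (size β)))
⊑⇒size≤ (sf-¬ p) = m≤n⇒m≤1+n (⊑⇒size≤ p)
⊑⇒size≤ (sf-□ p) = m≤n⇒m≤1+n (⊑⇒size≤ p)
⊑⇒size≤ (sf-◇ p) = m≤n⇒m≤1+n (⊑⇒size≤ p)

sizes-bounded : ∀ xs → All (λ g → size g < suc (sum (map size xs))) xs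
sizes-bounded [] = []
sizes-bounded (x ∷ xs) =
  s≤s (m≤m+n (size x) _) ∷ All.map (λ lt → ≤-trans lt (s≤s (m≤n+m _ (size x)))) (sizes-bounded xs)

module _ {A : Set} (p : A → Bool) where

  all-true⁻ : ∀ {xs x} → all p xs ≡ true → x ∈ xs → p x ≡ true
  all-true⁻ e (here refl) = ∧-true⁻ˡ e
  all-true⁻ {y ∷ _} e (there x∈xs) = all-true⁻ (∧-true⁻ʳ {p y} e) x∈xs

  all-true⁺ : ∀ xs → (∀ {x} → x ∈ xs → p x ≡ true) → all p xs ≡ true
  all-true⁺ [] _ = refl
  all-true⁺ (x ∷ xs) h = ∧-true⁺ (h (here refl)) (all-true⁺ xs (h ∘ there))

  all-false⁻ : ∀ xs → all p xs ≡ false → ∃[ x ] (x ∈ xs × p x ≡ false)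
  all-false⁻ (x ∷ xs) e with ∧-false⁻ {p x} e
  ... | inj₁ e' = x , here refl , e'
  ... | inj₂ e' with all-false⁻ xs e'
  ...   | y , y∈xs , e'' = y , there y∈xs , e''

  all-false⁺ : ∀ {xs x} → x ∈ xs → p x ≡ false → all p xs ≡ false
  all-false⁺ (here refl) e = ∧-false⁺ (inj₁ e)
  all-false⁺ {y ∷ _} (there x∈xs) e = ∧-false⁺ {p y} (inj₂ (all-false⁺ x∈xs e))

  any-false⁻ : ∀ {xs x} → any p xs ≡ false → x ∈ xs → p x ≡ false
  any-false⁻ e (here refl) = proj₁ (∨-false⁻ e)
  any-false⁻ {y ∷ _} e (there x∈xs) = any-false⁻ (proj₂ (∨-false⁻ {p y} e)) x∈xs

  any-false⁺ : ∀ xs → (∀ {x} → x ∈ xs → p x ≡ false) → any p xs ≡ false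
  any-false⁺ [] _ = refl
  any-false⁺ (x ∷ xs) h = ∨-false⁺ (h (here refl)) (any-false⁺ xs (h ∘ there))

  any-true⁻ : ∀ xs → any p xs ≡ true → ∃[ x ] (x ∈ xs × p x ≡ true)
  any-true⁻ (x ∷ xs) e with ∨-true⁻ {p x} e
  ... | inj₁ e' = x , here refl , e'
  ... | inj₂ e' with any-true⁻ xs e'
  ...   | y , y∈xs , e'' = y , there y∈xs , e''

  any-true⁺ : ∀ {xs x} → x ∈ xs → p x ≡ true → any p xs ≡ true
  any-true⁺ (here refl) e = ∨-true⁺ (inj₁ e)
  any-true⁺ {y ∷ _} (there x∈xs) e = ∨-true⁺ {p y} (inj₂ (any-true⁺ x∈xs e))

unsatisfied : ∀ {P : Fm → Set} → (∀ x → Dec (P x)) → List Fm → ℕ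
unsatisfied P? [] = 0
unsatisfied P? (x ∷ xs) with P? x
... | yes _ = unsatisfied P? xs
... | no _ = suc (unsatisfied P? xs)

module _ {P Q : Fm → Set} (P? : ∀ x → Dec (P x)) (Q? : ∀ x → Dec (Q x)) (P⇒Q : ∀ {x} → P x → Q x) where

  unsatisfied-mono : ∀ xs → unsatisfied Q? xs ≤ unsatisfied P? xs
  unsatisfied-mono [] = z≤n
  unsatisfied-mono (x ∷ xs) with P? x | Q? x
  ... | yes _ | yes _ = unsatisfied-mono xs
  ... | yes p | no ¬q = ⊥-elim (¬q (P⇒Q p))
  ... | no _ | yes _ = m≤n⇒m≤1+n (unsatisfied-mono xs)
  ... | no _ | no _ = s≤s (unsatisfied-mono xs)

  unsatisfied-mono-< : ∀ {a} xs → a ∈ xs → (P a → ⊥) → Q a → unsatisfied Q? xs < unsatisfied P? xs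
  unsatisfied-mono-< (x ∷ xs) (here refl) ¬pa qa with P? x | Q? x
  ... | yes pa | _ = ⊥-elim (¬pa pa)
  ... | no _ | no ¬qa = ⊥-elim (¬qa qa)
  ... | no _ | yes _ = s≤s (unsatisfied-mono xs)
  unsatisfied-mono-< (x ∷ xs) (there a∈xs) ¬pa qa with P? x | Q? x
  ... | yes _ | yes _ = unsatisfied-mono-< xs a∈xs ¬pa qa
  ... | yes p | no ¬q = ⊥-elim (¬q (P⇒Q p))
  ... | no _ | yes _ = m≤n⇒m≤1+n (unsatisfied-mono-< xs a∈xs ¬pa qa)
  ... | no _ | no _ = s≤s (unsatisfied-mono-< xs a∈xs ¬pa qa)

all-or-any : ∀ {A : Set} {P Q : A → Set} → (∀ x → P x ⊎ Q x) → ∀ xs → All P xs ⊎ ∃[ x ] (x ∈ xs × Q x)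
all-or-any p-or-q [] = inj₁ []
all-or-any p-or-q (x ∷ xs) with p-or-q x | all-or-any p-or-q xs
... | inj₂ q | _ = inj₂ (x , here refl , q)
... | inj₁ _ | inj₂ (y , y∈xs , q) = inj₂ (y , there y∈xs , q)
... | inj₁ p | inj₁ ps = inj₁ (p ∷ ps)

Analytic : ∀ {J} → (List J → J → Set) → (J → List Fm) → J → Set
Analytic R fm c = Σ (Deriv R c) λ P → ∀ φ → φ ∈ concatMap fm (nodes P) → φ ⊑* fm c

AnalyticStep : ∀ {J} → (J → List Fm) → List J → J → Set
AnalyticStep fm ps c = ∀ {p} → p ∈ ps → ∀ {φ} → φ ∈ fm p → φ ⊑* fm c

module _ {J : Set} {R : List J → J → Set} {fm : J → List Fm} where

  private
    ∈-concatMap-++⁻ : ∀ xs ys {φ} → φ ∈ concatMap fm (xs ++ ys) →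
                      φ ∈ concatMap fm xs ⊎ φ ∈ concatMap fm ys
    ∈-concatMap-++⁻ [] ys m = inj₂ m
    ∈-concatMap-++⁻ (x ∷ xs) ys m with ∈-++⁻ (fm x) m
    ... | inj₁ m' = inj₁ (∈-++⁺ˡ m')
    ... | inj₂ m' with ∈-concatMap-++⁻ xs ys m'
    ...   | inj₁ m'' = inj₁ (∈-++⁺ʳ (fm x) m'')
    ...   | inj₂ m'' = inj₂ m''

    nodesAll-⊑* : ∀ {ps} (ds : All (Analytic R fm) ps) {φ} →
                  φ ∈ concatMap fm (nodesAll (All.map proj₁ ds)) → ∃[ p ] (p ∈ ps × φ ⊑* fm p)
    nodesAll-⊑* (d ∷ ds) m with ∈-concatMap-++⁻ (nodes (proj₁ d)) (nodesAll (All.map proj₁ ds)) m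
    ... | inj₁ m' = _ , here refl , proj₂ d _ m'
    ... | inj₂ m' with nodesAll-⊑* ds m'
    ...   | p , p∈ps , φ⊑* = p , there p∈ps , φ⊑*

  analytic-node : ∀ {ps c} → R ps c → AnalyticStep fm ps c → All (Analytic R fm) ps → Analytic R fm c
  analytic-node {c = c} r step ds = node r (All.map proj₁ ds) , inside
    where
    inside : ∀ φ → φ ∈ concatMap fm (nodes (node r (All.map proj₁ ds))) → φ ⊑* fm c
    inside φ m with ∈-++⁻ (fm c) m
    ... | inj₁ m' = ∈⇒⊑* m'
    ... | inj₂ m' with nodesAll-⊑* ds m'
    ...   | p , p∈ps , (ψ , ψ∈p , φ⊑ψ) = ⊑-⊑*-trans φ⊑ψ (step p∈ps ψ∈p)

Extension : Set
Extension = List Fm × List Fm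

extend : List Fm → List Fm → Extension → Seq
extend L R (cs , ds) = cs ++ L ⇒ ds ++ R

Included : List Fm → List Fm → Extension → Set
Included L R (cs , ds) = cs ⊆ L × ds ⊆ R

ExtensionBy : Fm → Extension → Set
ExtensionBy f (cs , ds) = All (_⊑ f) cs × All (_⊑ f) ds

-- The premises of the rule decomposing a formula on the left (right), each given by what it adds to
-- the antecedent and succedent; nothing for formulas without such a rule.
leftPremises : Bool → Fm → Maybe (List Extension)
leftPremises _ (a ∧ b) = just [ (a ∷ b ∷ [] , []) ]
leftPremises _ (a ∨ b) = just (([ a ] , []) ∷ ([ b ] , []) ∷ [])
leftPremises _ (a ⊃ b) = just (([] , [ a ]) ∷ ([ b ] , []) ∷ [])
leftPremises _ (¬ ¬ a) = just [ ([ a ] , []) ]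
leftPremises _ (¬ (a ∧ b)) = just (([] , [ a ]) ∷ ([] , [ b ]) ∷ [])
leftPremises _ (¬ (a ∨ b)) = just [ ([] , a ∷ b ∷ []) ]
leftPremises _ (¬ (a ⊃ b)) = just [ ([ a ] , [ b ]) ]
leftPremises true (□ a) = just [ ([ a ] , []) ]
leftPremises true (¬ ◇ a) = just [ ([] , [ a ]) ]
leftPremises _ _ = nothing

rightPremises : Bool → Fm → Maybe (List Extension)
rightPremises _ (a ∧ b) = just (([] , [ a ]) ∷ ([] , [ b ]) ∷ [])
rightPremises _ (a ∨ b) = just [ ([] , a ∷ b ∷ []) ]
rightPremises _ (a ⊃ b) = just [ ([ a ] , [ b ]) ]
rightPremises _ (¬ ¬ a) = just [ ([] , [ a ]) ]
rightPremises _ (¬ (a ∧ b)) = just [ (a ∷ b ∷ [] , []) ]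
rightPremises _ (¬ (a ∨ b)) = just (([ a ] , []) ∷ ([ b ] , []) ∷ [])
rightPremises _ (¬ (a ⊃ b)) = just (([] , [ a ]) ∷ ([ b ] , []) ∷ [])
rightPremises true (◇ a) = just [ ([] , [ a ]) ]
rightPremises true (¬ □ a) = just [ ([ a ] , []) ]
rightPremises _ _ = nothing

leftPremises-⊑ : ∀ T f {exts} → leftPremises T f ≡ just exts → All (ExtensionBy f) exts
leftPremises-⊑ _ (a ∧ b) refl = (⊑∧ˡ ∷ ⊑∧ʳ ∷ [] , []) ∷ []
leftPremises-⊑ _ (a ∨ b) refl = (⊑∨ˡ ∷ [] , []) ∷ (⊑∨ʳ ∷ [] , []) ∷ []
leftPremises-⊑ _ (a ⊃ b) refl = ([] , ⊑⊃ˡ ∷ []) ∷ (⊑⊃ʳ ∷ [] , []) ∷ []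
leftPremises-⊑ _ (¬ ¬ a) refl = (sf-¬ ⊑¬ ∷ [] , []) ∷ []
leftPremises-⊑ _ (¬ (a ∧ b)) refl = ([] , sf-¬ ⊑∧ˡ ∷ []) ∷ ([] , sf-¬ ⊑∧ʳ ∷ []) ∷ []
leftPremises-⊑ _ (¬ (a ∨ b)) refl = ([] , sf-¬ ⊑∨ˡ ∷ sf-¬ ⊑∨ʳ ∷ []) ∷ []
leftPremises-⊑ _ (¬ (a ⊃ b)) refl = (sf-¬ ⊑⊃ˡ ∷ [] , sf-¬ ⊑⊃ʳ ∷ []) ∷ []
leftPremises-⊑ true (□ a) refl = (⊑□ ∷ [] , []) ∷ []
leftPremises-⊑ true (¬ ◇ a) refl = ([] , sf-¬ ⊑◇ ∷ []) ∷ []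
leftPremises-⊑ false (□ a) ()
leftPremises-⊑ false (¬ ◇ a) ()
leftPremises-⊑ _ (var _) ()
leftPremises-⊑ _ (◇ _) ()
leftPremises-⊑ _ (¬ var _) ()
leftPremises-⊑ _ (¬ □ _) ()

rightPremises-⊑ : ∀ T f {exts} → rightPremises T f ≡ just exts → All (ExtensionBy f) exts
rightPremises-⊑ _ (a ∧ b) refl = ([] , ⊑∧ˡ ∷ []) ∷ ([] , ⊑∧ʳ ∷ []) ∷ []
rightPremises-⊑ _ (a ∨ b) refl = ([] , ⊑∨ˡ ∷ ⊑∨ʳ ∷ []) ∷ []
rightPremises-⊑ _ (a ⊃ b) refl = (⊑⊃ˡ ∷ [] , ⊑⊃ʳ ∷ []) ∷ []
rightPremises-⊑ _ (¬ ¬ a) refl = ([] , sf-¬ ⊑¬ ∷ []) ∷ []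
rightPremises-⊑ _ (¬ (a ∧ b)) refl = (sf-¬ ⊑∧ˡ ∷ sf-¬ ⊑∧ʳ ∷ [] , []) ∷ []
rightPremises-⊑ _ (¬ (a ∨ b)) refl = (sf-¬ ⊑∨ˡ ∷ [] , []) ∷ (sf-¬ ⊑∨ʳ ∷ [] , []) ∷ []
rightPremises-⊑ _ (¬ (a ⊃ b)) refl = ([] , sf-¬ ⊑⊃ˡ ∷ []) ∷ (sf-¬ ⊑⊃ʳ ∷ [] , []) ∷ []
rightPremises-⊑ true (◇ a) refl = ([] , ⊑◇ ∷ []) ∷ []
rightPremises-⊑ true (¬ □ a) refl = (sf-¬ ⊑□ ∷ [] , []) ∷ []
rightPremises-⊑ false (◇ a) ()
rightPremises-⊑ false (¬ □ a) ()
rightPremises-⊑ _ (var _) ()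
rightPremises-⊑ _ (□ _) ()
rightPremises-⊑ _ (¬ var _) ()
rightPremises-⊑ _ (¬ ◇ _) ()

Saturated : Maybe (List Extension) → List Fm → List Fm → Set
Saturated nothing _ _ = ⊤
Saturated (just exts) L R = Any (Included L R) exts

saturated? : ∀ m L R → Dec (Saturated m L R)
saturated? nothing L R = yes tt
saturated? (just exts) L R = any? (λ (cs , ds) → cs ⊆? L ×-dec ds ⊆? R) exts

NewIn : List Fm → List Fm → Set
NewIn cs L = ∃[ x ] (x ∈ cs × x ∉ L)

Progress : List Fm → List Fm → Extension → Set
Progress L R (cs , ds) = NewIn cs L ⊎ NewIn ds R

⊈⇒NewIn : ∀ cs L → (cs ⊆ L → ⊥) → NewIn cs L
⊈⇒NewIn [] L cs⊈L = ⊥-elim (cs⊈L λ ())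
⊈⇒NewIn (c ∷ cs) L c∷cs⊈L with c ∈? L
... | no c∉L = c , here refl , c∉L
... | yes c∈L with ⊈⇒NewIn cs L (c∷cs⊈L ∘ ∈-∷⁺ʳ c∈L)
...   | x , x∈cs , x∉L = x , there x∈cs , x∉L

unincluded⇒progress : ∀ {L R} e → (Included L R e → ⊥) → Progress L R e
unincluded⇒progress {L} {R} (cs , ds) e⊈ with cs ⊆? L
... | no cs⊈L = inj₁ (⊈⇒NewIn cs L cs⊈L)
... | yes cs⊆L = inj₂ (⊈⇒NewIn ds R (λ ds⊆R → e⊈ (cs⊆L , ds⊆R)))

unsaturated-extensions : ∀ {f L R exts} → (Saturated (just exts) L R → ⊥) → All (ExtensionBy f) exts →
                         All (λ e → ExtensionBy f e × Progress L R e) exts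
unsaturated-extensions {exts = []} _ [] = []
unsaturated-extensions {exts = e ∷ exts} unsat (by ∷ bys) =
  (by , unincluded⇒progress e (unsat ∘ here)) ∷ unsaturated-extensions (unsat ∘ there) bys

measure : List Fm → List Fm → List Fm → ℕ
measure U L R = unsatisfied (_∈? L) U + unsatisfied (_∈? R) U

private
  unsatisfied-++ : ∀ U cs L → unsatisfied (_∈? (cs ++ L)) U ≤ unsatisfied (_∈? L) U
  unsatisfied-++ U cs L = unsatisfied-mono (_∈? L) (_∈? (cs ++ L)) (∈-++⁺ʳ cs) U

  unsatisfied-++-< : ∀ U cs L → cs ⊆ U → NewIn cs L → unsatisfied (_∈? (cs ++ L)) U < unsatisfied (_∈? L) U
  unsatisfied-++-< U cs L cs⊆U (x , x∈cs , x∉L) =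
    unsatisfied-mono-< (_∈? L) (_∈? (cs ++ L)) (∈-++⁺ʳ cs) U (cs⊆U x∈cs) x∉L (∈-++⁺ˡ x∈cs)

measure-decreases : ∀ U {L R cs ds} → cs ⊆ U → ds ⊆ U → Progress L R (cs , ds) →
                    measure U (cs ++ L) (ds ++ R) < measure U L R
measure-decreases U {L} {R} {cs} {ds} cs⊆U _ (inj₁ new) =
  +-mono-<-≤ (unsatisfied-++-< U cs L cs⊆U new) (unsatisfied-++ U ds R)
measure-decreases U {L} {R} {cs} {ds} _ ds⊆U (inj₂ new) =
  +-mono-≤-< (unsatisfied-++ U cs L) (unsatisfied-++-< U ds R ds⊆U new)

□-saturated : ∀ T {a L R} → Saturated (leftPremises T (□ a)) L R → T ≡ true → a ∈ L
□-saturated true (here (a⊆L , _)) refl = a⊆L (here refl)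
□-saturated true (there ()) refl

¬◇-saturated : ∀ T {a L R} → Saturated (leftPremises T (¬ ◇ a)) L R → T ≡ true → a ∈ R
¬◇-saturated true (here (_ , a⊆R)) refl = a⊆R (here refl)
¬◇-saturated true (there ()) refl

◇-saturated : ∀ T {a L R} → Saturated (rightPremises T (◇ a)) L R → T ≡ true → a ∈ R
◇-saturated true (here (_ , a⊆R)) refl = a⊆R (here refl)
◇-saturated true (there ()) refl

¬□-saturated : ∀ T {a L R} → Saturated (rightPremises T (¬ □ a)) L R → T ≡ true → a ∈ L
¬□-saturated true (here (a⊆L , _)) refl = a⊆L (here refl)
¬□-saturated true (there ()) refl

extension-⊑* : ∀ {f L R X} e → ExtensionBy f e → f ⊑* X →
               (∀ {φ} → φ ∈ L → φ ⊑* X) → (∀ {φ} → φ ∈ R → φ ⊑* X) →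
               ∀ {φ} → φ ∈ seqFmls (extend L R e) → φ ⊑* X
extension-⊑* {L = L} (cs , ds) (cs⊑f , ds⊑f) f⊑*X L⊑*X R⊑*X m with ∈-++⁻ (cs ++ L) m
... | inj₁ m' with ∈-++⁻ cs m'
...   | inj₁ φ∈cs = ⊑-⊑*-trans (All.lookup cs⊑f φ∈cs) f⊑*X
...   | inj₂ φ∈L = L⊑*X φ∈L
extension-⊑* (cs , ds) (cs⊑f , ds⊑f) f⊑*X L⊑*X R⊑*X m | inj₂ m' with ∈-++⁻ ds m'
...   | inj₁ φ∈ds = ⊑-⊑*-trans (All.lookup ds⊑f φ∈ds) f⊑*X
...   | inj₂ φ∈R = R⊑*X φ∈R

-- L ⇒ R is a weakening of an initial sequent
data Closed (L R : List Fm) : Set where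
  var-both : ∀ {p} → var p ∈ L → var p ∈ R → Closed L R
  neg-both : ∀ {p} → ¬ var p ∈ L → ¬ var p ∈ R → Closed L R
  clash-left : ∀ {p} → ¬ var p ∈ L → var p ∈ L → Closed L R
  clash-right : ∀ {p} → ¬ var p ∈ R → var p ∈ R → Closed L R

private
  ClosesLeft : List Fm → List Fm → Fm → Set
  ClosesLeft L R (var p) = var p ∈ R
  ClosesLeft L R (¬ var p) = ¬ var p ∈ R ⊎ var p ∈ L
  ClosesLeft _ _ _ = ⊥

  closesLeft? : ∀ L R f → Dec (ClosesLeft L R f)
  closesLeft? L R (var p) = var p ∈? R
  closesLeft? L R (¬ var p) = ¬ var p ∈? R ⊎-dec var p ∈? L
  closesLeft? L R (_ ∧ _) = no λ ()
  closesLeft? L R (_ ∨ _) = no λ ()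
  closesLeft? L R (_ ⊃ _) = no λ ()
  closesLeft? L R (□ _) = no λ ()
  closesLeft? L R (◇ _) = no λ ()
  closesLeft? L R (¬ (_ ∧ _)) = no λ ()
  closesLeft? L R (¬ (_ ∨ _)) = no λ ()
  closesLeft? L R (¬ (_ ⊃ _)) = no λ ()
  closesLeft? L R (¬ ¬ _) = no λ ()
  closesLeft? L R (¬ □ _) = no λ ()
  closesLeft? L R (¬ ◇ _) = no λ ()

  ClosesRight : List Fm → Fm → Set
  ClosesRight R (var p) = ¬ var p ∈ R
  ClosesRight _ _ = ⊥

  closesRight? : ∀ R f → Dec (ClosesRight R f)
  closesRight? R (var p) = ¬ var p ∈? R
  closesRight? R (_ ∧ _) = no λ ()
  closesRight? R (_ ∨ _) = no λ ()
  closesRight? R (_ ⊃ _) = no λ ()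
  closesRight? R (¬ _) = no λ ()
  closesRight? R (□ _) = no λ ()
  closesRight? R (◇ _) = no λ ()

  closesLeft⇒closed : ∀ {L R f} → f ∈ L → ClosesLeft L R f → Closed L R
  closesLeft⇒closed {f = var p} f∈L c = var-both f∈L c
  closesLeft⇒closed {f = ¬ var p} f∈L (inj₁ c) = neg-both f∈L c
  closesLeft⇒closed {f = ¬ var p} f∈L (inj₂ c) = clash-left f∈L c

  closesRight⇒closed : ∀ {L R f} → f ∈ R → ClosesRight R f → Closed L R
  closesRight⇒closed {f = var p} f∈R c = clash-right c f∈R

  closed⇒closes : ∀ {L R} → Closed L R → Any (ClosesLeft L R) L ⊎ Any (ClosesRight R) R
  closed⇒closes (var-both l r) = inj₁ (Any.map (λ { refl → r }) l)
  closed⇒closes (neg-both l r) = inj₁ (Any.map (λ { refl → inj₁ r }) l)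
  closed⇒closes (clash-left l l') = inj₁ (Any.map (λ { refl → inj₂ l' }) l)
  closed⇒closes (clash-right r r') = inj₂ (Any.map (λ { refl → r }) r')

closed? : ∀ L R → Dec (Closed L R)
closed? L R with any? (closesLeft? L R) L | any? (closesRight? R) R
... | yes c | _ = let _ , f∈L , closes = find c in yes (closesLeft⇒closed f∈L closes)
... | no _ | yes c = let _ , f∈R , closes = find c in yes (closesRight⇒closed f∈R closes)
... | no ¬l | no ¬r = no λ c → Sum.[ ¬l , ¬r ] (closed⇒closes c)

unbox undiamond unneg : Fm → List Fm
unbox (□ a) = [ a ]
unbox _ = []
undiamond (◇ a) = [ a ]
undiamond _ = []
unneg (¬ a) = [ a ]
unneg _ = []

boxed diamonded negated : List Fm → List Fm
boxed = concatMap unbox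
diamonded = concatMap undiamond
negated = concatMap unneg

private
  unbox-inv : ∀ x → All (λ a → □ a ≡ x) (unbox x)
  unbox-inv (□ a) = refl ∷ []
  unbox-inv (var _) = []
  unbox-inv (_ ∧ _) = []
  unbox-inv (_ ∨ _) = []
  unbox-inv (_ ⊃ _) = []
  unbox-inv (¬ _) = []
  unbox-inv (◇ _) = []

  undiamond-inv : ∀ x → All (λ a → ◇ a ≡ x) (undiamond x)
  undiamond-inv (◇ a) = refl ∷ []
  undiamond-inv (var _) = []
  undiamond-inv (_ ∧ _) = []
  undiamond-inv (_ ∨ _) = []
  undiamond-inv (_ ⊃ _) = []
  undiamond-inv (¬ _) = []
  undiamond-inv (□ _) = []

  unneg-inv : ∀ x → All (λ a → ¬ a ≡ x) (unneg x)
  unneg-inv (¬ a) = refl ∷ []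
  unneg-inv (var _) = []
  unneg-inv (_ ∧ _) = []
  unneg-inv (_ ∨ _) = []
  unneg-inv (_ ⊃ _) = []
  unneg-inv (□ _) = []
  unneg-inv (◇ _) = []

∈-boxed⁺ : ∀ {a L} → □ a ∈ L → a ∈ boxed L
∈-boxed⁺ m = ∈-concatMap⁺ unbox (Any.map (λ { refl → here refl }) m)

∈-boxed⁻ : ∀ {a L} → a ∈ boxed L → □ a ∈ L
∈-boxed⁻ m = Any.map (λ {x} → All.lookup (unbox-inv x)) (∈-concatMap⁻ unbox m)

∈-diamonded⁺ : ∀ {a L} → ◇ a ∈ L → a ∈ diamonded L
∈-diamonded⁺ m = ∈-concatMap⁺ undiamond (Any.map (λ { refl → here refl }) m)

∈-diamonded⁻ : ∀ {a L} → a ∈ diamonded L → ◇ a ∈ L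
∈-diamonded⁻ m = Any.map (λ {x} → All.lookup (undiamond-inv x)) (∈-concatMap⁻ undiamond m)

∈-negated⁺ : ∀ {a L} → ¬ a ∈ L → a ∈ negated L
∈-negated⁺ m = ∈-concatMap⁺ unneg (Any.map (λ { refl → here refl }) m)

∈-negated⁻ : ∀ {a L} → a ∈ negated L → ¬ a ∈ L
∈-negated⁻ m = Any.map (λ {x} → All.lookup (unneg-inv x)) (∈-concatMap⁻ unneg m)

K-context-⊑* : ∀ Γ₁ Γ₂ Δ₁ Δ₂ {X} → map □_ Γ₁ ++ map (λ x → ¬ ◇ x) Γ₂ ⊆ X →
               map ◇_ Δ₁ ++ map (λ x → ¬ □ x) Δ₂ ⊆ X →
               All (_⊑* X) Γ₁ × All (_⊑* X) Γ₂ × All (_⊑* X) Δ₁ × All (_⊑* X) Δ₂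
K-context-⊑* Γ₁ Γ₂ Δ₁ Δ₂ ant⊆X suc⊆X =
    tabulate (λ m → ⊑-⊑*-trans ⊑□ (∈⇒⊑* (ant⊆X (∈-++⁺ˡ (∈-map⁺ □_ m)))))
  , tabulate (λ m → ⊑-⊑*-trans (sf-¬ ⊑◇) (∈⇒⊑* (ant⊆X (∈-++⁺ʳ (map □_ Γ₁) (∈-map⁺ (λ x → ¬ ◇ x) m)))))
  , tabulate (λ m → ⊑-⊑*-trans ⊑◇ (∈⇒⊑* (suc⊆X (∈-++⁺ˡ (∈-map⁺ ◇_ m)))))
  , tabulate (λ m → ⊑-⊑*-trans (sf-¬ ⊑□) (∈⇒⊑* (suc⊆X (∈-++⁺ʳ (map ◇_ Δ₁) (∈-map⁺ (λ x → ¬ □ x) m)))))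

-- Tree models of gTK and gTKT

-- Finite trees whose children are the successors of a world; for T = true every world also sees
-- itself, so evaluation is over a reflexive model exactly when the calculus has the T-rules.
module TreeModels (T : Bool) where

  data Tree : Set where
    world : (ℕ → Bool) → List Tree → Tree

  children : Tree → List Tree
  children (world _ ts) = ts

  eval : Fm → Tree → Bool
  eval (var p) (world v _) = v p
  eval (a ∧ b) t = eval a t && eval b t
  eval (a ∨ b) t = eval a t || eval b t
  eval (a ⊃ b) t = not (eval a t) || eval b t
  eval (¬ a) t = not (eval a t)
  eval (□ a) t = (not T || eval a t) && all (eval a) (children t)
  eval (◇ a) t = (T && eval a t) || any (eval a) (children t)

  Holds Fails : Tree → Fm → Set
  Holds t f = eval f t ≡ true
  Fails t f = eval f t ≡ false

  Refutes : Tree → Seq → Set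
  Refutes t (Γ ⇒ Δ) = All (Holds t) Γ × All (Fails t) Δ

  Accessible : Tree → Tree → Set
  Accessible t w = (∀ a → Holds t (□ a) → Holds w a) × (∀ a → Fails t (◇ a) → Fails w a)

  child-accessible : ∀ {t w} → w ∈ children t → Accessible t w
  child-accessible {t} w∈ts =
      (λ a e → all-true⁻ (eval a) (∧-true⁻ʳ {not T || eval a t} e) w∈ts)
    , (λ a e → any-false⁻ (eval a) (proj₂ (∨-false⁻ {T && eval a t} e)) w∈ts)

  reflexive-accessible : ∀ {t} → T ≡ true → Accessible t t
  reflexive-accessible refl = (λ _ → ∧-true⁻ˡ) , (λ _ e → proj₁ (∨-false⁻ e))

  □-false⁻ : ∀ t a → Fails t (□ a) → ∃[ w ] (Accessible t w × Fails w a)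
  □-false⁻ t a e with ∧-false⁻ {not T || eval a t} e
  ... | inj₁ e' = t , reflexive-accessible (not-false⁻ (proj₁ (∨-false⁻ {not T} e'))) , proj₂ (∨-false⁻ {not T} e')
  ... | inj₂ e' with all-false⁻ (eval a) (children t) e'
  ...   | w , w∈ts , e'' = w , child-accessible w∈ts , e''

  ◇-true⁻ : ∀ t a → Holds t (◇ a) → ∃[ w ] (Accessible t w × Holds w a)
  ◇-true⁻ t a e with ∨-true⁻ {T && eval a t} e
  ... | inj₁ e' = t , reflexive-accessible (∧-true⁻ˡ e') , ∧-true⁻ʳ {T} e'
  ... | inj₂ e' with any-true⁻ (eval a) (children t) e'
  ...   | w , w∈ts , e'' = w , child-accessible w∈ts , e''

  K-context : ∀ {t w} Γ₁ Γ₂ {Δ₁ Δ₂} → Accessible t w →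
              All (Holds t) (map □_ Γ₁ ++ map (λ x → ¬ ◇ x) Γ₂) →
              All (Fails t) (map ◇_ Δ₁) → All (Fails t) (map (λ x → ¬ □ x) Δ₂) →
              All (Holds w) (Γ₁ ++ Δ₂) × All (Fails w) Δ₁ × All (Fails w) Γ₂
  K-context Γ₁ Γ₂ (□⇒ , ◇⇒) hs f◇ f¬□ with ++⁻ (map □_ Γ₁) hs
  ... | h□ , h¬◇ =
      ++⁺ (All.map (λ {x} → □⇒ x) (map⁻ h□)) (All.map (λ {x} → □⇒ x ∘ not-false⁻) (map⁻ f¬□))
    , All.map (λ {x} → ◇⇒ x) (map⁻ f◇)
    , All.map (λ {x} → ◇⇒ x ∘ not-true⁻) (map⁻ h¬◇)

  soundness : ∀ {S} → Deriv (GK T) S → ∀ t → Refutes t S → ⊥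
  soundness (node (set-eq (Γ⊆Γ' , _) (Δ⊆Δ' , _)) (d ∷ [])) t (hs , fs) =
    soundness d t (All-resp-⊇ Γ⊆Γ' hs , All-resp-⊇ Δ⊆Δ' fs)
  soundness (node (init-1 p) []) t (h ∷ [] , f ∷ []) = true-and-false h f
  soundness (node (init-2 p) []) t (h ∷ [] , f ∷ []) = true-and-false h f
  soundness (node (init-3 p) []) t (h¬ ∷ h ∷ [] , []) = true-and-false h (not-true⁻ h¬)
  soundness (node (init-4 p) []) t ([] , f¬ ∷ f ∷ []) = true-and-false (not-false⁻ f¬) f
  soundness (node (cut {α = α}) (d₁ ∷ d₂ ∷ [])) t (hs , fs) with eval α t in e
  ... | true = soundness d₂ t (e ∷ hs , fs)
  ... | false = soundness d₁ t (hs , e ∷ [])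
  soundness (node we-left (d ∷ [])) t (_ ∷ hs , fs) = soundness d t (hs , fs)
  soundness (node we-right (d ∷ [])) t (hs , _ ∷ fs) = soundness d t (hs , fs)
  soundness (node (∧left {α = α}) (d ∷ [])) t (h ∷ hs , fs) =
    soundness d t (∧-true⁻ˡ h ∷ ∧-true⁻ʳ {eval α t} h ∷ hs , fs)
  soundness (node (∧right {α = α}) (d₁ ∷ d₂ ∷ [])) t (hs , f ∷ fs) with ∧-false⁻ {eval α t} f
  ... | inj₁ e = soundness d₁ t (hs , e ∷ fs)
  ... | inj₂ e = soundness d₂ t (hs , e ∷ fs)
  soundness (node (∨left {α = α}) (d₁ ∷ d₂ ∷ [])) t (h ∷ hs , fs) with ∨-true⁻ {eval α t} h
  ... | inj₁ e = soundness d₁ t (e ∷ hs , fs)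
  ... | inj₂ e = soundness d₂ t (e ∷ hs , fs)
  soundness (node (∨right {α = α}) (d ∷ [])) t (hs , f ∷ fs) =
    soundness d t (hs , proj₁ (∨-false⁻ {eval α t} f) ∷ proj₂ (∨-false⁻ {eval α t} f) ∷ fs)
  soundness (node (⊃left {α = α}) (d₁ ∷ d₂ ∷ [])) t (h ∷ hs , fs) with ∨-true⁻ {not (eval α t)} h
  ... | inj₁ e = soundness d₁ t (hs , not-true⁻ e ∷ fs)
  ... | inj₂ e = soundness d₂ t (e ∷ hs , fs)
  soundness (node (⊃right {α = α}) (d ∷ [])) t (hs , f ∷ fs) =
    soundness d t (not-false⁻ (proj₁ (∨-false⁻ {not (eval α t)} f)) ∷ hs , proj₂ (∨-false⁻ {not (eval α t)} f) ∷ fs)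
  soundness (node ¬¬left (d ∷ [])) t (h ∷ hs , fs) = soundness d t (not-false⁻ (not-true⁻ h) ∷ hs , fs)
  soundness (node ¬¬right (d ∷ [])) t (hs , f ∷ fs) = soundness d t (hs , not-true⁻ (not-false⁻ f) ∷ fs)
  soundness (node (¬∧left {α = α}) (d₁ ∷ d₂ ∷ [])) t (h ∷ hs , fs) with ∧-false⁻ {eval α t} (not-true⁻ h)
  ... | inj₁ e = soundness d₁ t (hs , e ∷ fs)
  ... | inj₂ e = soundness d₂ t (hs , e ∷ fs)
  soundness (node (¬∧right {α = α}) (d ∷ [])) t (hs , f ∷ fs) =
    soundness d t (∧-true⁻ˡ (not-false⁻ f) ∷ ∧-true⁻ʳ {eval α t} (not-false⁻ f) ∷ hs , fs)
  soundness (node (¬∨left {α = α}) (d ∷ [])) t (h ∷ hs , fs) =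
    soundness d t (hs , proj₁ (∨-false⁻ {eval α t} (not-true⁻ h)) ∷ proj₂ (∨-false⁻ {eval α t} (not-true⁻ h)) ∷ fs)
  soundness (node (¬∨right {α = α}) (d₁ ∷ d₂ ∷ [])) t (hs , f ∷ fs) with ∨-true⁻ {eval α t} (not-false⁻ f)
  ... | inj₁ e = soundness d₁ t (e ∷ hs , fs)
  ... | inj₂ e = soundness d₂ t (e ∷ hs , fs)
  soundness (node (¬⊃left {α = α}) (d ∷ [])) t (h ∷ hs , fs) =
    soundness d t (not-false⁻ (proj₁ (∨-false⁻ {not (eval α t)} (not-true⁻ h))) ∷ hs
                  , proj₂ (∨-false⁻ {not (eval α t)} (not-true⁻ h)) ∷ fs)
  soundness (node (¬⊃right {α = α}) (d₁ ∷ d₂ ∷ [])) t (hs , f ∷ fs) with ∨-true⁻ {not (eval α t)} (not-false⁻ f)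
  ... | inj₁ e = soundness d₁ t (hs , not-true⁻ e ∷ fs)
  ... | inj₂ e = soundness d₂ t (e ∷ hs , fs)
  soundness (node (□K-right {Γ₁} {Γ₂} {Δ₁} {Δ₂} {α}) (d ∷ [])) t (hs , fs)
    with ++⁻ (map ◇_ Δ₁) fs
  ... | f◇ , fs' with ++⁻ (map (λ x → ¬ □ x) Δ₂) fs'
  ...   | f¬□ , f□α ∷ [] with □-false⁻ t α f□α
  ...     | w , acc , fα with K-context Γ₁ Γ₂ acc hs f◇ f¬□
  ...       | hw , fΔ₁ , fΓ₂ = soundness d w (hw , ++⁺ fΔ₁ (++⁺ fΓ₂ (fα ∷ [])))
  soundness (node (◇K-left {Γ₁} {Γ₂} {Δ₁} {Δ₂} {α}) (d ∷ [])) t (h◇α ∷ hs , fs)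
    with ++⁻ (map ◇_ Δ₁) fs | ◇-true⁻ t α h◇α
  ... | f◇ , f¬□ | w , acc , hα with K-context Γ₁ Γ₂ acc hs f◇ f¬□
  ...   | hw , fΔ₁ , fΓ₂ = soundness d w (hα ∷ hw , ++⁺ fΔ₁ fΓ₂)
  soundness (node (¬□K-left {Γ₁} {Γ₂} {Δ₁} {Δ₂} {α}) (d ∷ [])) t (h¬□α ∷ hs , fs)
    with ++⁻ (map ◇_ Δ₁) fs | □-false⁻ t α (not-true⁻ h¬□α)
  ... | f◇ , f¬□ | w , acc , fα with K-context Γ₁ Γ₂ acc hs f◇ f¬□
  ...   | hw , fΔ₁ , fΓ₂ = soundness d w (hw , ++⁺ fΔ₁ (++⁺ fΓ₂ (fα ∷ [])))
  soundness (node (¬◇K-right {Γ₁} {Γ₂} {Δ₁} {Δ₂} {α}) (d ∷ [])) t (hs , fs)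
    with ++⁻ (map ◇_ Δ₁) fs
  ... | f◇ , fs' with ++⁻ (map (λ x → ¬ □ x) Δ₂) fs'
  ...   | f¬□ , f¬◇α ∷ [] with ◇-true⁻ t α (not-false⁻ f¬◇α)
  ...     | w , acc , hα with K-context Γ₁ Γ₂ acc hs f◇ f¬□
  ...       | hw , fΔ₁ , fΓ₂ = soundness d w (hα ∷ hw , ++⁺ fΔ₁ fΓ₂)
  soundness (node (□left {α = α} T≡true) (d ∷ [])) t (h ∷ hs , fs) =
    soundness d t (proj₁ (reflexive-accessible {t} T≡true) α h ∷ hs , fs)
  soundness (node (◇right {α = α} T≡true) (d ∷ [])) t (hs , f ∷ fs) =
    soundness d t (hs , proj₂ (reflexive-accessible {t} T≡true) α f ∷ fs)
  soundness (node (¬□right {α = α} T≡true) (d ∷ [])) t (hs , f ∷ fs) =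
    soundness d t (proj₁ (reflexive-accessible {t} T≡true) α (not-false⁻ f) ∷ hs , fs)
  soundness (node (¬◇left {α = α} T≡true) (d ∷ [])) t (h ∷ hs , fs) =
    soundness d t (hs , proj₂ (reflexive-accessible {t} T≡true) α (not-true⁻ h) ∷ fs)

-- Proof search in gTK and gTKT

gk-leftRule : ∀ T f {exts L R} → leftPremises T f ≡ just exts → GK T (map (extend L R) exts) (f ∷ L ⇒ R)
gk-leftRule _ (a ∧ b) refl = ∧left
gk-leftRule _ (a ∨ b) refl = ∨left
gk-leftRule _ (a ⊃ b) refl = ⊃left
gk-leftRule _ (¬ ¬ a) refl = ¬¬left
gk-leftRule _ (¬ (a ∧ b)) refl = ¬∧left
gk-leftRule _ (¬ (a ∨ b)) refl = ¬∨left
gk-leftRule _ (¬ (a ⊃ b)) refl = ¬⊃left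
gk-leftRule true (□ a) refl = □left refl
gk-leftRule true (¬ ◇ a) refl = ¬◇left refl
gk-leftRule false (□ a) ()
gk-leftRule false (¬ ◇ a) ()
gk-leftRule _ (var _) ()
gk-leftRule _ (◇ _) ()
gk-leftRule _ (¬ var _) ()
gk-leftRule _ (¬ □ _) ()

gk-rightRule : ∀ T f {exts L R} → rightPremises T f ≡ just exts → GK T (map (extend L R) exts) (L ⇒ f ∷ R)
gk-rightRule _ (a ∧ b) refl = ∧right
gk-rightRule _ (a ∨ b) refl = ∨right
gk-rightRule _ (a ⊃ b) refl = ⊃right
gk-rightRule _ (¬ ¬ a) refl = ¬¬right
gk-rightRule _ (¬ (a ∧ b)) refl = ¬∧right
gk-rightRule _ (¬ (a ∨ b)) refl = ¬∨right
gk-rightRule _ (¬ (a ⊃ b)) refl = ¬⊃right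
gk-rightRule true (◇ a) refl = ◇right refl
gk-rightRule true (¬ □ a) refl = ¬□right refl
gk-rightRule false (◇ a) ()
gk-rightRule false (¬ □ a) ()
gk-rightRule _ (var _) ()
gk-rightRule _ (□ _) ()
gk-rightRule _ (¬ var _) ()
gk-rightRule _ (¬ ◇ _) ()

module SequentSearch (T : Bool) where
  open TreeModels T

  Provable : Seq → Set
  Provable = Analytic (GK T) seqFmls

  Decision : Seq → Set
  Decision S = Provable S ⊎ Σ Tree (λ t → Refutes t S)

  by-rule₀ : ∀ {c} → GK T [] c → Provable c
  by-rule₀ r = analytic-node r (λ ()) []

  by-rule₁ : ∀ {p c} → GK T [ p ] c → (∀ {φ} → φ ∈ seqFmls p → φ ⊑* seqFmls c) → Provable p → Provable c
  by-rule₁ r step d = analytic-node r (λ { (here refl) → step ; (there ()) }) (d ∷ [])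

  by-set-eq : ∀ {Γ Γ' Δ Δ'} → Γ ≋ Γ' → Δ ≋ Δ' → Provable (Γ ⇒ Δ) → Provable (Γ' ⇒ Δ')
  by-set-eq Γ≋Γ' Δ≋Δ' = by-rule₁ (set-eq Γ≋Γ' Δ≋Δ') (∈⇒⊑* ∘ Subset.++⁺ (proj₁ Γ≋Γ') (proj₁ Δ≋Δ'))

  weakenˡ : ∀ M {Γ Δ} → Provable (Γ ⇒ Δ) → Provable (M ++ Γ ⇒ Δ)
  weakenˡ [] d = d
  weakenˡ (_ ∷ M) d = by-rule₁ we-left (∈⇒⊑* ∘ there) (weakenˡ M d)

  weakenʳ : ∀ M {Γ Δ} → Provable (Γ ⇒ Δ) → Provable (Γ ⇒ M ++ Δ)
  weakenʳ [] d = d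
  weakenʳ (_ ∷ M) {Γ} d = by-rule₁ we-right (∈⇒⊑* ∘ Subset.++⁺ʳ Γ there) (weakenʳ M d)

  weaken : ∀ {Γ Δ L R} → Γ ⊆ L → Δ ⊆ R → Provable (Γ ⇒ Δ) → Provable (L ⇒ R)
  weaken {L = L} {R} Γ⊆L Δ⊆R d = by-set-eq (⊆-absorbʳ Γ⊆L) (⊆-absorbʳ Δ⊆R) (weakenˡ L (weakenʳ R d))

  contractˡ : ∀ {f L R} → f ∈ L → Provable (f ∷ L ⇒ R) → Provable (L ⇒ R)
  contractˡ f∈L = by-set-eq (∷-absorb f∈L) ≋-refl

  contractʳ : ∀ {f L R} → f ∈ R → Provable (L ⇒ f ∷ R) → Provable (L ⇒ R)
  contractʳ f∈R = by-set-eq ≋-refl (∷-absorb f∈R)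

  refutes-extension : ∀ {t L R} e → Refutes t (extend L R e) → Refutes t (L ⇒ R)
  refutes-extension (cs , ds) (hs , fs) = ++⁻ʳ cs hs , ++⁻ʳ ds fs

  all-provable-or-refuted : ∀ {L R} exts → All (Decision ∘ extend L R) exts →
                            All (Provable ∘ extend L R) exts ⊎ Σ Tree (λ t → Refutes t (L ⇒ R))
  all-provable-or-refuted [] [] = inj₁ []
  all-provable-or-refuted (e ∷ _) (inj₂ (t , refuted) ∷ _) = inj₂ (t , refutes-extension e refuted)
  all-provable-or-refuted (e ∷ exts) (inj₁ d ∷ ds) with all-provable-or-refuted exts ds
  ... | inj₁ ps = inj₁ (d ∷ ps)
  ... | inj₂ refuted = inj₂ refuted

  extensions-⊑* : ∀ {f L R c} exts → All (ExtensionBy f) exts → f ⊑* seqFmls c →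
                  L ⊆ seqFmls c → R ⊆ seqFmls c → AnalyticStep seqFmls (map (extend L R) exts) c
  extensions-⊑* {L = L} {R} exts bys f⊑* L⊆ R⊆ p∈ with ∈-map⁻ (extend L R) p∈
  ... | e , e∈exts , refl = extension-⊑* e (All.lookup bys e∈exts) f⊑* (∈⇒⊑* ∘ L⊆) (∈⇒⊑* ∘ R⊆)

  apply-left : ∀ {f L R} exts → GK T (map (extend L R) exts) (f ∷ L ⇒ R) → f ∈ L →
               All (ExtensionBy f) exts → All (Decision ∘ extend L R) exts → Decision (L ⇒ R)
  apply-left {f} {L} {R} exts r f∈L bys ds with all-provable-or-refuted exts ds
  ... | inj₂ refuted = inj₂ refuted
  ... | inj₁ ps = inj₁ (contractˡ f∈L (analytic-node r step (map⁺ ps)))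
    where
    step : AnalyticStep seqFmls (map (extend L R) exts) (f ∷ L ⇒ R)
    step = extensions-⊑* {c = f ∷ L ⇒ R} exts bys (∈⇒⊑* (here refl)) (there ∘ ∈-++⁺ˡ) (∈-++⁺ʳ (f ∷ L))

  apply-right : ∀ {f L R} exts → GK T (map (extend L R) exts) (L ⇒ f ∷ R) → f ∈ R →
                All (ExtensionBy f) exts → All (Decision ∘ extend L R) exts → Decision (L ⇒ R)
  apply-right {f} {L} {R} exts r f∈R bys ds with all-provable-or-refuted exts ds
  ... | inj₂ refuted = inj₂ refuted
  ... | inj₁ ps = inj₁ (contractʳ f∈R (analytic-node r step (map⁺ ps)))
    where
    step : AnalyticStep seqFmls (map (extend L R) exts) (L ⇒ f ∷ R)
    step = extensions-⊑* {c = L ⇒ f ∷ R} exts bys (∈⇒⊑* (∈-++⁺ʳ L (here refl))) ∈-++⁺ˡ (∈-++⁺ʳ L ∘ there)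

  Expansion : List Fm → List Fm → List Fm → Set
  Expansion X L R = ∀ {f} e → f ⊑* X → ExtensionBy f e → Progress L R e → Decision (extend L R e)

  decompose-left : ∀ {X L R} → Expansion X L R → ∀ {f} → f ∈ L → f ⊑* X →
                   (Saturated (leftPremises T f) L R → ⊥) → Decision (L ⇒ R)
  decompose-left expand {f} f∈L f⊑*X unsat with leftPremises T f in eq
  ... | nothing = ⊥-elim (unsat tt)
  ... | just exts = apply-left exts (gk-leftRule T f eq) f∈L bys
                      (All.map (uncurry (expand _ f⊑*X)) (unsaturated-extensions unsat bys))
    where
    bys : All (ExtensionBy f) exts
    bys = leftPremises-⊑ T f eq

  decompose-right : ∀ {X L R} → Expansion X L R → ∀ {f} → f ∈ R → f ⊑* X →
                    (Saturated (rightPremises T f) L R → ⊥) → Decision (L ⇒ R)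
  decompose-right expand {f} f∈R f⊑*X unsat with rightPremises T f in eq
  ... | nothing = ⊥-elim (unsat tt)
  ... | just exts = apply-right exts (gk-rightRule T f eq) f∈R bys
                      (All.map (uncurry (expand _ f⊑*X)) (unsaturated-extensions unsat bys))
    where
    bys : All (ExtensionBy f) exts
    bys = rightPremises-⊑ T f eq

  closed⇒provable : ∀ {L R} → Closed L R → Provable (L ⇒ R)
  closed⇒provable (var-both l r) = weaken (∈-∷⁺ʳ l λ ()) (∈-∷⁺ʳ r λ ()) (by-rule₀ (init-1 _))
  closed⇒provable (neg-both l r) = weaken (∈-∷⁺ʳ l λ ()) (∈-∷⁺ʳ r λ ()) (by-rule₀ (init-2 _))
  closed⇒provable (clash-left l l') = weaken (∈-∷⁺ʳ l (∈-∷⁺ʳ l' λ ())) (λ ()) (by-rule₀ (init-3 _))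
  closed⇒provable (clash-right r r') = weaken (λ ()) (∈-∷⁺ʳ r (∈-∷⁺ʳ r' λ ())) (by-rule₀ (init-4 _))

  module _ {Q : Fm → Tree → Set} where

    witnesses : ∀ {xs} → All (λ a → Σ Tree (Q a)) xs → List Tree
    witnesses = All.reduce proj₁

    witnesses-cover : ∀ {xs} (refs : All (λ a → Σ Tree (Q a)) xs) →
                      All (λ a → ∃[ c ] (c ∈ witnesses refs × Q a c)) xs
    witnesses-cover [] = []
    witnesses-cover ((c , q) ∷ refs) =
      (c , here refl , q) ∷ All.map (λ (c' , c'∈ , q') → c' , there c'∈ , q') (witnesses-cover refs)

    witnesses-satisfy : ∀ {B : Tree → Set} {xs} → (∀ {a c} → Q a c → B c) →
                        (refs : All (λ a → Σ Tree (Q a)) xs) → All B (witnesses refs)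
    witnesses-satisfy f [] = []
    witnesses-satisfy f ((_ , q) ∷ refs) = f q ∷ witnesses-satisfy f refs

  first-provable-or-refutations : ∀ (P : Fm → Seq) {xs} → All (Decision ∘ P) xs →
                                  ∃[ a ] (a ∈ xs × Provable (P a)) ⊎ All (λ a → Σ Tree (λ t → Refutes t (P a))) xs
  first-provable-or-refutations P [] = inj₂ []
  first-provable-or-refutations P (inj₁ d ∷ _) = inj₁ (_ , here refl , d)
  first-provable-or-refutations P (inj₂ r ∷ ds) with first-provable-or-refutations P ds
  ... | inj₁ (a , a∈ , d) = inj₁ (a , there a∈ , d)
  ... | inj₂ rs = inj₂ (r ∷ rs)

  module KStep (L R : List Fm) where

    Γ₁ Γ₂ Δ₁ Δ₂ : List Fm
    Γ₁ = boxed L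
    Γ₂ = diamonded (negated L)
    Δ₁ = diamonded R
    Δ₂ = boxed (negated R)

    boxPremise diamondPremise : Fm → Seq
    boxPremise a = Γ₁ ++ Δ₂ ⇒ Δ₁ ++ Γ₂ ++ [ a ]
    diamondPremise a = a ∷ Γ₁ ++ Δ₂ ⇒ Δ₁ ++ Γ₂

    -- the formulas that must fail, respectively hold, at some successor world
    boxDemands diamondDemands : List Fm
    boxDemands = boxed R ++ boxed (negated L)
    diamondDemands = diamonded L ++ diamonded (negated R)

    K-antecedent K-succedent : List Fm
    K-antecedent = map □_ Γ₁ ++ map (λ x → ¬ ◇ x) Γ₂
    K-succedent = map ◇_ Δ₁ ++ map (λ x → ¬ □ x) Δ₂

    K-antecedent⊆L : K-antecedent ⊆ L
    K-antecedent⊆L m with ∈-++⁻ (map □_ Γ₁) m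
    ... | inj₁ m' with ∈-map⁻ □_ m'
    ...   | _ , a∈ , refl = ∈-boxed⁻ a∈
    K-antecedent⊆L m | inj₂ m' with ∈-map⁻ (λ x → ¬ ◇ x) m'
    ...   | _ , a∈ , refl = ∈-negated⁻ (∈-diamonded⁻ a∈)

    K-succedent⊆R : K-succedent ⊆ R
    K-succedent⊆R m with ∈-++⁻ (map ◇_ Δ₁) m
    ... | inj₁ m' with ∈-map⁻ ◇_ m'
    ...   | _ , a∈ , refl = ∈-diamonded⁻ a∈
    K-succedent⊆R m | inj₂ m' with ∈-map⁻ (λ x → ¬ □ x) m'
    ...   | _ , a∈ , refl = ∈-negated⁻ (∈-boxed⁻ a∈)

    PremiseFormulas : Seq → Fm → Set
    PremiseFormulas p x = ∀ {X} → K-antecedent ⊆ X → K-succedent ⊆ X → x ∈ X → All (_⊑* X) (seqFmls p)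

    boxPremise-⊑* : ∀ {a x} → a ⊑ x → PremiseFormulas (boxPremise a) x
    boxPremise-⊑* a⊑x ant⊆ suc⊆ x∈ with K-context-⊑* Γ₁ Γ₂ Δ₁ Δ₂ ant⊆ suc⊆
    ... | g₁ , g₂ , d₁ , d₂ = ++⁺ (++⁺ g₁ d₂) (++⁺ d₁ (++⁺ g₂ (⊑-⊑*-trans a⊑x (∈⇒⊑* x∈) ∷ [])))

    diamondPremise-⊑* : ∀ {a x} → a ⊑ x → PremiseFormulas (diamondPremise a) x
    diamondPremise-⊑* a⊑x ant⊆ suc⊆ x∈ with K-context-⊑* Γ₁ Γ₂ Δ₁ Δ₂ ant⊆ suc⊆
    ... | g₁ , g₂ , d₁ , d₂ = ⊑-⊑*-trans a⊑x (∈⇒⊑* x∈) ∷ ++⁺ (++⁺ g₁ d₂) (++⁺ d₁ g₂)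

    by-K-right : ∀ {p x} → GK T [ p ] (K-antecedent ⇒ map ◇_ Δ₁ ++ map (λ y → ¬ □ y) Δ₂ ++ [ x ]) →
                 x ∈ R → PremiseFormulas p x → Provable p → Provable (L ⇒ R)
    by-K-right {x = x} r x∈R premise-⊑* d =
      weaken K-antecedent⊆L succedent⊆R (by-rule₁ r (All.lookup (premise-⊑* ant⊆ suc⊆ x∈)) d)
      where
      succedent⊆R : map ◇_ Δ₁ ++ map (λ y → ¬ □ y) Δ₂ ++ [ x ] ⊆ R
      succedent⊆R m with ∈-++⁻ (map ◇_ Δ₁) m
      ... | inj₁ m' = K-succedent⊆R (∈-++⁺ˡ m')
      ... | inj₂ m' with ∈-++⁻ (map (λ y → ¬ □ y) Δ₂) m'
      ...   | inj₁ m'' = K-succedent⊆R (∈-++⁺ʳ (map ◇_ Δ₁) m'')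
      ...   | inj₂ (here refl) = x∈R
      conclusion : List Fm
      conclusion = K-antecedent ++ map ◇_ Δ₁ ++ map (λ y → ¬ □ y) Δ₂ ++ [ x ]
      ant⊆ : K-antecedent ⊆ conclusion
      ant⊆ = Subset.xs⊆xs++ys K-antecedent _
      suc⊆ : K-succedent ⊆ conclusion
      suc⊆ = Subset.⊆-trans (Subset.++⁺ʳ (map ◇_ Δ₁) (Subset.xs⊆xs++ys _ [ x ])) (Subset.xs⊆ys++xs _ K-antecedent)
      x∈ : x ∈ conclusion
      x∈ = ∈-++⁺ʳ K-antecedent (∈-++⁺ʳ (map ◇_ Δ₁) (∈-++⁺ʳ (map (λ y → ¬ □ y) Δ₂) (here refl)))

    by-K-left : ∀ {p x} → GK T [ p ] (x ∷ K-antecedent ⇒ K-succedent) →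
                x ∈ L → PremiseFormulas p x → Provable p → Provable (L ⇒ R)
    by-K-left r x∈L premise-⊑* d =
      weaken (∈-∷⁺ʳ x∈L K-antecedent⊆L) K-succedent⊆R
        (by-rule₁ r (All.lookup (premise-⊑* (there ∘ Subset.xs⊆xs++ys _ _) (there ∘ Subset.xs⊆ys++xs _ K-antecedent)
                                            (here refl))) d)

    boxDemand⇒ : ∀ {a} → a ∈ boxDemands → Provable (boxPremise a) → Provable (L ⇒ R)
    boxDemand⇒ m with ∈-++⁻ (boxed R) m
    ... | inj₁ a∈ = by-K-right (□K-right {Γ₁ = Γ₁} {Γ₂} {Δ₁} {Δ₂}) (∈-boxed⁻ a∈) (boxPremise-⊑* ⊑□)
    ... | inj₂ a∈ =
      by-K-left (¬□K-left {Γ₁ = Γ₁} {Γ₂} {Δ₁} {Δ₂}) (∈-negated⁻ (∈-boxed⁻ a∈)) (boxPremise-⊑* (sf-¬ ⊑□))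

    diamondDemand⇒ : ∀ {a} → a ∈ diamondDemands → Provable (diamondPremise a) → Provable (L ⇒ R)
    diamondDemand⇒ m with ∈-++⁻ (diamonded L) m
    ... | inj₁ a∈ = by-K-left (◇K-left {Γ₁ = Γ₁} {Γ₂} {Δ₁} {Δ₂}) (∈-diamonded⁻ a∈) (diamondPremise-⊑* ⊑◇)
    ... | inj₂ a∈ =
      by-K-right (¬◇K-right {Γ₁ = Γ₁} {Γ₂} {Δ₁} {Δ₂}) (∈-negated⁻ (∈-diamonded⁻ a∈)) (diamondPremise-⊑* (sf-¬ ⊑◇))

    Base : Tree → Set
    Base c = Refutes c (Γ₁ ++ Δ₂ ⇒ Δ₁ ++ Γ₂)

    boxPremise-base : ∀ {a c} → Refutes c (boxPremise a) → Base c
    boxPremise-base (hs , fs) = hs , ++⁺ (++⁻ˡ Δ₁ fs) (++⁻ˡ Γ₂ (++⁻ʳ Δ₁ fs))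

    diamondPremise-base : ∀ {a c} → Refutes c (diamondPremise a) → Base c
    diamondPremise-base (_ ∷ hs , fs) = hs , fs

    module Truth (satL : All (λ f → Saturated (leftPremises T f) L R) L)
                 (satR : All (λ f → Saturated (rightPremises T f) L R) R)
                 (unclosed : Closed L R → ⊥)
                 (cs : List Tree) (base : All Base cs)
                 (box-witness : All (λ a → ∃[ c ] (c ∈ cs × Fails c a)) boxDemands)
                 (diamond-witness : All (λ a → ∃[ c ] (c ∈ cs × Holds c a)) diamondDemands) where

      t : Tree
      t = world (λ p → var p ∈ᵇ L || ¬ var p ∈ᵇ R) cs

      mutual
        true-left : ∀ f → f ∈ L → Holds t f
        true-left (var p) m = ∨-true⁺ (inj₁ (∈⇒∈ᵇ m))
        true-left (¬ var p) m =
          not-true⁺ (∨-false⁺ (∉⇒∉ᵇ (unclosed ∘ clash-left m)) (∉⇒∉ᵇ (unclosed ∘ neg-both m)))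
        true-left (a ∧ b) m with All.lookup satL m
        ... | here (ab⊆L , _) = ∧-true⁺ (true-left a (ab⊆L (here refl))) (true-left b (ab⊆L (there (here refl))))
        true-left (a ∨ b) m with All.lookup satL m
        ... | here (a⊆L , _) = ∨-true⁺ (inj₁ (true-left a (a⊆L (here refl))))
        ... | there (here (b⊆L , _)) = ∨-true⁺ {eval a t} (inj₂ (true-left b (b⊆L (here refl))))
        true-left (a ⊃ b) m with All.lookup satL m
        ... | here (_ , a⊆R) = ∨-true⁺ (inj₁ (not-true⁺ (false-right a (a⊆R (here refl)))))
        ... | there (here (b⊆L , _)) = ∨-true⁺ {not (eval a t)} (inj₂ (true-left b (b⊆L (here refl))))
        true-left (¬ ¬ a) m with All.lookup satL m
        ... | here (a⊆L , _) = not-true⁺ (not-false⁺ (true-left a (a⊆L (here refl))))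
        true-left (¬ (a ∧ b)) m with All.lookup satL m
        ... | here (_ , a⊆R) = not-true⁺ (∧-false⁺ (inj₁ (false-right a (a⊆R (here refl)))))
        ... | there (here (_ , b⊆R)) = not-true⁺ (∧-false⁺ {eval a t} (inj₂ (false-right b (b⊆R (here refl)))))
        true-left (¬ (a ∨ b)) m with All.lookup satL m
        ... | here (_ , ab⊆R) =
          not-true⁺ (∨-false⁺ (false-right a (ab⊆R (here refl))) (false-right b (ab⊆R (there (here refl)))))
        true-left (¬ (a ⊃ b)) m with All.lookup satL m
        ... | here (a⊆L , b⊆R) =
          not-true⁺ (∨-false⁺ (not-false⁺ (true-left a (a⊆L (here refl)))) (false-right b (b⊆R (here refl))))
        true-left (□ a) m =
          ∧-true⁺ (guarded-true T (λ T≡true → true-left a (□-saturated T (All.lookup satL m) T≡true)))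
                  (all-true⁺ (eval a) cs (λ c∈ → All.lookup (proj₁ (All.lookup base c∈)) (∈-++⁺ˡ (∈-boxed⁺ m))))
        true-left (◇ a) m with All.lookup diamond-witness (∈-++⁺ˡ (∈-diamonded⁺ m))
        ... | c , c∈ , holds = ∨-true⁺ {T && eval a t} (inj₂ (any-true⁺ (eval a) c∈ holds))
        true-left (¬ □ a) m with All.lookup box-witness (∈-++⁺ʳ (boxed R) (∈-boxed⁺ (∈-negated⁺ m)))
        ... | c , c∈ , fails = not-true⁺ (∧-false⁺ {not T || eval a t} (inj₂ (all-false⁺ (eval a) c∈ fails)))
        true-left (¬ ◇ a) m =
          not-true⁺ (∨-false⁺ (guarded-false T (λ T≡true → false-right a (¬◇-saturated T (All.lookup satL m) T≡true)))
                              (any-false⁺ (eval a) cs (λ c∈ → All.lookup (proj₂ (All.lookup base c∈))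
                                                             (∈-++⁺ʳ Δ₁ (∈-diamonded⁺ (∈-negated⁺ m))))))

        false-right : ∀ f → f ∈ R → Fails t f
        false-right (var p) m = ∨-false⁺ (∉⇒∉ᵇ (λ l → unclosed (var-both l m))) (∉⇒∉ᵇ (λ r → unclosed (clash-right r m)))
        false-right (¬ var p) m = not-false⁺ (∨-true⁺ {var p ∈ᵇ L} (inj₂ (∈⇒∈ᵇ m)))
        false-right (a ∧ b) m with All.lookup satR m
        ... | here (_ , a⊆R) = ∧-false⁺ (inj₁ (false-right a (a⊆R (here refl))))
        ... | there (here (_ , b⊆R)) = ∧-false⁺ {eval a t} (inj₂ (false-right b (b⊆R (here refl))))
        false-right (a ∨ b) m with All.lookup satR m
        ... | here (_ , ab⊆R) = ∨-false⁺ (false-right a (ab⊆R (here refl))) (false-right b (ab⊆R (there (here refl))))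
        false-right (a ⊃ b) m with All.lookup satR m
        ... | here (a⊆L , b⊆R) = ∨-false⁺ (not-false⁺ (true-left a (a⊆L (here refl)))) (false-right b (b⊆R (here refl)))
        false-right (¬ ¬ a) m with All.lookup satR m
        ... | here (_ , a⊆R) = not-false⁺ (not-true⁺ (false-right a (a⊆R (here refl))))
        false-right (¬ (a ∧ b)) m with All.lookup satR m
        ... | here (ab⊆L , _) = not-false⁺ (∧-true⁺ (true-left a (ab⊆L (here refl))) (true-left b (ab⊆L (there (here refl)))))
        false-right (¬ (a ∨ b)) m with All.lookup satR m
        ... | here (a⊆L , _) = not-false⁺ (∨-true⁺ (inj₁ (true-left a (a⊆L (here refl)))))
        ... | there (here (b⊆L , _)) = not-false⁺ (∨-true⁺ {eval a t} (inj₂ (true-left b (b⊆L (here refl)))))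
        false-right (¬ (a ⊃ b)) m with All.lookup satR m
        ... | here (_ , a⊆R) = not-false⁺ (∨-true⁺ (inj₁ (not-true⁺ (false-right a (a⊆R (here refl))))))
        ... | there (here (b⊆L , _)) = not-false⁺ (∨-true⁺ {not (eval a t)} (inj₂ (true-left b (b⊆L (here refl)))))
        false-right (□ a) m with All.lookup box-witness (∈-++⁺ˡ (∈-boxed⁺ m))
        ... | c , c∈ , fails = ∧-false⁺ {not T || eval a t} (inj₂ (all-false⁺ (eval a) c∈ fails))
        false-right (◇ a) m =
          ∨-false⁺ (guarded-false T (λ T≡true → false-right a (◇-saturated T (All.lookup satR m) T≡true)))
                   (any-false⁺ (eval a) cs (λ c∈ → All.lookup (proj₂ (All.lookup base c∈)) (∈-++⁺ˡ (∈-diamonded⁺ m))))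
        false-right (¬ □ a) m =
          not-false⁺ (∧-true⁺ (guarded-true T (λ T≡true → true-left a (¬□-saturated T (All.lookup satR m) T≡true)))
                              (all-true⁺ (eval a) cs (λ c∈ → All.lookup (proj₁ (All.lookup base c∈))
                                                              (∈-++⁺ʳ Γ₁ (∈-boxed⁺ (∈-negated⁺ m))))))
        false-right (¬ ◇ a) m with All.lookup diamond-witness (∈-++⁺ʳ (diamonded L) (∈-diamonded⁺ (∈-negated⁺ m)))
        ... | c , c∈ , holds = not-false⁺ (∨-true⁺ {T && eval a t} (inj₂ (any-true⁺ (eval a) c∈ holds)))

      countermodel : Refutes t (L ⇒ R)
      countermodel = tabulate (true-left _) , tabulate (false-right _)

    modal-step : All (λ f → Saturated (leftPremises T f) L R) L → All (λ f → Saturated (rightPremises T f) L R) R →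
                 (Closed L R → ⊥) → All (Decision ∘ boxPremise) boxDemands →
                 All (Decision ∘ diamondPremise) diamondDemands → Decision (L ⇒ R)
    modal-step satL satR unclosed boxDs diamondDs with first-provable-or-refutations boxPremise boxDs
    ... | inj₁ (_ , a∈ , d) = inj₁ (boxDemand⇒ a∈ d)
    ... | inj₂ boxRefs with first-provable-or-refutations diamondPremise diamondDs
    ...   | inj₁ (_ , a∈ , d) = inj₁ (diamondDemand⇒ a∈ d)
    ...   | inj₂ diamondRefs = inj₂ (M.t , M.countermodel)
      where
      successors : List Tree
      successors = witnesses boxRefs ++ witnesses diamondRefs
      module M = Truth satL satR unclosed successors
        (++⁺ (witnesses-satisfy boxPremise-base boxRefs) (witnesses-satisfy diamondPremise-base diamondRefs))
        (All.map (λ (c , c∈ , (_ , fs)) → c , ∈-++⁺ˡ c∈ , All.lookup fs (∈-++⁺ʳ Δ₁ (∈-++⁺ʳ Γ₂ (here refl))))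
                 (witnesses-cover boxRefs))
        (All.map (λ (c , c∈ , (hs , _)) → c , ∈-++⁺ʳ (witnesses boxRefs) c∈ , All.head hs)
                 (witnesses-cover diamondRefs))

  module Saturation (n : ℕ) (search< : ∀ L R → All (λ g → size g < n) (L ++ R) → Decision (L ⇒ R))
                    (X : List Fm) (X-bounded : All (λ g → size g < suc n) X) where

    U : List Fm
    U = concatMap subformulas X

    under-modality : ∀ {a x} → x ⊑* X → suc (size a) ≤ size x → size a < n
    under-modality (ψ , ψ∈X , x⊑ψ) le = ≤-trans le (≤-pred (≤-<-trans (⊑⇒size≤ x⊑ψ) (All.lookup X-bounded ψ∈X)))

    module _ {M : List Fm} (M⊑X : All (_⊑* X) M) where

      boxed-bounded : All (λ a → size a < n) (boxed M)
      boxed-bounded = tabulate λ a∈ → under-modality (All.lookup M⊑X (∈-boxed⁻ a∈)) ≤-refl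

      diamonded-bounded : All (λ a → size a < n) (diamonded M)
      diamonded-bounded = tabulate λ a∈ → under-modality (All.lookup M⊑X (∈-diamonded⁻ a∈)) ≤-refl

      negated-boxed-bounded : All (λ a → size a < n) (boxed (negated M))
      negated-boxed-bounded = tabulate λ a∈ → under-modality (All.lookup M⊑X (∈-negated⁻ (∈-boxed⁻ a∈))) (n≤1+n _)

      negated-diamonded-bounded : All (λ a → size a < n) (diamonded (negated M))
      negated-diamonded-bounded =
        tabulate λ a∈ → under-modality (All.lookup M⊑X (∈-negated⁻ (∈-diamonded⁻ a∈))) (n≤1+n _)

    modal-search : ∀ {L R} → All (_⊑* X) L → All (_⊑* X) R →
                   All (Decision ∘ KStep.boxPremise L R) (KStep.boxDemands L R) ×
                   All (Decision ∘ KStep.diamondPremise L R) (KStep.diamondDemands L R)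
    modal-search {L} {R} L⊑X R⊑X =
        All.map (λ a< → search< _ _ (++⁺ context (++⁺ (diamonded-bounded R⊑X)
                                                      (++⁺ (negated-diamonded-bounded L⊑X) (a< ∷ [])))))
                (++⁺ (boxed-bounded R⊑X) (negated-boxed-bounded L⊑X))
      , All.map (λ a< → search< _ _ (++⁺ (a< ∷ context) (++⁺ (diamonded-bounded R⊑X) (negated-diamonded-bounded L⊑X))))
                (++⁺ (diamonded-bounded L⊑X) (negated-diamonded-bounded R⊑X))
      where
      context : All (λ a → size a < n) (boxed L ++ boxed (negated R))
      context = ++⁺ (boxed-bounded L⊑X) (negated-boxed-bounded R⊑X)

    mutual
      saturate : ∀ fuel L R → All (_⊑* X) L → All (_⊑* X) R → measure U L R < fuel → Decision (L ⇒ R)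
      saturate zero _ _ _ _ ()
      saturate (suc fuel) L R L⊑X R⊑X m<fuel with all? (λ f → saturated? (leftPremises T f) L R) L
      ... | no unsatL = let _ , f∈L , unsat = find (¬All⇒Any¬ (λ f → saturated? (leftPremises T f) L R) L unsatL)
                        in decompose-left (expand fuel L⊑X R⊑X (≤-pred m<fuel)) f∈L (All.lookup L⊑X f∈L) unsat
      ... | yes satL with all? (λ f → saturated? (rightPremises T f) L R) R
      ...   | no unsatR = let _ , f∈R , unsat = find (¬All⇒Any¬ (λ f → saturated? (rightPremises T f) L R) R unsatR)
                          in decompose-right (expand fuel L⊑X R⊑X (≤-pred m<fuel)) f∈R (All.lookup R⊑X f∈R) unsat
      ...   | yes satR with closed? L R
      ...     | yes closed = inj₁ (closed⇒provable closed)
      ...     | no unclosed = uncurry (KStep.modal-step L R satL satR unclosed) (modal-search L⊑X R⊑X)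

      expand : ∀ fuel {L R} → All (_⊑* X) L → All (_⊑* X) R → measure U L R ≤ fuel → Expansion X L R
      expand fuel {L} {R} L⊑X R⊑X m≤fuel (cs , ds) f⊑X (cs⊑f , ds⊑f) progress =
        saturate fuel (cs ++ L) (ds ++ R) (++⁺ cs⊑X L⊑X) (++⁺ ds⊑X R⊑X)
          (<-≤-trans (measure-decreases U (⊑*⇒∈subformulas ∘ All.lookup cs⊑X) (⊑*⇒∈subformulas ∘ All.lookup ds⊑X) progress)
                     m≤fuel)
        where
        cs⊑X : All (_⊑* X) cs
        cs⊑X = All.map (λ c⊑f → ⊑-⊑*-trans c⊑f f⊑X) cs⊑f
        ds⊑X : All (_⊑* X) ds
        ds⊑X = All.map (λ d⊑f → ⊑-⊑*-trans d⊑f f⊑X) ds⊑f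

  search : ∀ n L R → All (λ g → size g < n) (L ++ R) → Decision (L ⇒ R)
  search zero [] [] [] = inj₂ (world (λ _ → false) [] , [] , [])
  search zero (_ ∷ _) _ (() ∷ _)
  search zero [] (_ ∷ _) (() ∷ _)
  search (suc n) L R bounded =
    saturate (suc (measure U L R)) L R (tabulate (∈⇒⊑* ∘ ∈-++⁺ˡ)) (tabulate (∈⇒⊑* ∘ ∈-++⁺ʳ L)) ≤-refl
    where open Saturation n (search n) (L ++ R) bounded

  complete : ∀ S → Deriv (GK T) S → Provable S
  complete (L ⇒ R) d with search (suc (sum (map size (L ++ R)))) L R (sizes-bounded (L ++ R))
  ... | inj₁ p = p
  ... | inj₂ (t , refuted) = ⊥-elim (soundness d t refuted)

-- S5 models of HTS5

-- An S5 countermodel is a finite list of worlds (valuations), each seeing all of them.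
module S5Models where

  Valuation : Set
  Valuation = ℕ → Bool

  eval : List Valuation → Fm → Valuation → Bool
  eval Ws (var p) v = v p
  eval Ws (a ∧ b) v = eval Ws a v && eval Ws b v
  eval Ws (a ∨ b) v = eval Ws a v || eval Ws b v
  eval Ws (a ⊃ b) v = not (eval Ws a v) || eval Ws b v
  eval Ws (¬ a) v = not (eval Ws a v)
  eval Ws (□ a) v = all (eval Ws a) Ws
  eval Ws (◇ a) v = any (eval Ws a) Ws

  Holds Fails : List Valuation → Valuation → Fm → Set
  Holds Ws v f = eval Ws f v ≡ true
  Fails Ws v f = eval Ws f v ≡ false

  RefutesAt : List Valuation → Valuation → Seq → Set
  RefutesAt Ws v (Γ ⇒ Δ) = All (Holds Ws v) Γ × All (Fails Ws v) Δ

  Refutes : List Valuation → HSeq → Set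
  Refutes Ws = All (λ S → ∃[ v ] (v ∈ Ws × RefutesAt Ws v S))

  soundness : ∀ {H} → Deriv HTS5 H → ∀ Ws → Refutes Ws H → ⊥
  soundness (node (perm H↭H') (d ∷ [])) Ws r = soundness d Ws (All-resp-↭ (↭-sym H↭H') r)
  soundness (node (comp-eq (Γ⊆Γ' , _) (Δ⊆Δ' , _)) (d ∷ [])) Ws ((v , v∈ , hs , fs) ∷ r) =
    soundness d Ws ((v , v∈ , All-resp-⊇ Γ⊆Γ' hs , All-resp-⊇ Δ⊆Δ' fs) ∷ r)
  soundness (node (init-1 p) []) Ws ((_ , _ , h ∷ [] , f ∷ []) ∷ _) = true-and-false h f
  soundness (node (init-2 p) []) Ws ((_ , _ , h ∷ [] , f ∷ []) ∷ _) = true-and-false h f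
  soundness (node (init-3 p) []) Ws ((_ , _ , h ∷ h¬ ∷ [] , []) ∷ _) = true-and-false h (not-true⁻ h¬)
  soundness (node (init-4 p) []) Ws ((_ , _ , [] , f ∷ f¬ ∷ []) ∷ _) = true-and-false (not-false⁻ f¬) f
  soundness (node (cut {Γ} {Δ} {α = α} {H}) (d₁ ∷ d₂ ∷ [])) Ws ((v , v∈ , hs , fs) ∷ r)
    with ++⁻ H r | eval Ws α v in e
  ... | _ , rG | true = soundness d₂ Ws ((v , v∈ , e ∷ ++⁻ʳ Γ hs , ++⁻ʳ Δ fs) ∷ rG)
  ... | rH , _ | false = soundness d₁ Ws ((v , v∈ , ++⁻ˡ Γ hs , e ∷ ++⁻ˡ Δ fs) ∷ rH)
  soundness (node (merge {Γ} {Δ}) (d ∷ [])) Ws ((v , v∈ , hs , fs) ∷ r) =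
    soundness d Ws ((v , v∈ , ++⁻ˡ Γ hs , ++⁻ˡ Δ fs) ∷ (v , v∈ , ++⁻ʳ Γ hs , ++⁻ʳ Δ fs) ∷ r)
  soundness (node in-we-left (d ∷ [])) Ws ((v , v∈ , _ ∷ hs , fs) ∷ r) = soundness d Ws ((v , v∈ , hs , fs) ∷ r)
  soundness (node in-we-right (d ∷ [])) Ws ((v , v∈ , hs , _ ∷ fs) ∷ r) = soundness d Ws ((v , v∈ , hs , fs) ∷ r)
  soundness (node ex-we-left (d ∷ [])) Ws (_ ∷ r) = soundness d Ws r
  soundness (node ex-we-right (d ∷ [])) Ws (_ ∷ r) = soundness d Ws r
  soundness (node (∧left {α = α}) (d ∷ [])) Ws ((v , v∈ , h ∷ hs , fs) ∷ r) =
    soundness d Ws ((v , v∈ , ∧-true⁻ˡ h ∷ ∧-true⁻ʳ {eval Ws α v} h ∷ hs , fs) ∷ r)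
  soundness (node (∧right {α = α} {H = H}) (d₁ ∷ d₂ ∷ [])) Ws ((v , v∈ , hs , f ∷ fs) ∷ r)
    with ++⁻ H r | ∧-false⁻ {eval Ws α v} f
  ... | rH , _ | inj₁ e = soundness d₁ Ws ((v , v∈ , hs , e ∷ fs) ∷ rH)
  ... | _ , rG | inj₂ e = soundness d₂ Ws ((v , v∈ , hs , e ∷ fs) ∷ rG)
  soundness (node (∨left {α = α} {H = H}) (d₁ ∷ d₂ ∷ [])) Ws ((v , v∈ , h ∷ hs , fs) ∷ r)
    with ++⁻ H r | ∨-true⁻ {eval Ws α v} h
  ... | rH , _ | inj₁ e = soundness d₁ Ws ((v , v∈ , e ∷ hs , fs) ∷ rH)
  ... | _ , rG | inj₂ e = soundness d₂ Ws ((v , v∈ , e ∷ hs , fs) ∷ rG)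
  soundness (node (∨right {α = α}) (d ∷ [])) Ws ((v , v∈ , hs , f ∷ fs) ∷ r) =
    soundness d Ws ((v , v∈ , hs , proj₁ (∨-false⁻ {eval Ws α v} f) ∷ proj₂ (∨-false⁻ {eval Ws α v} f) ∷ fs) ∷ r)
  soundness (node (⊃left {α = α} {H = H}) (d₁ ∷ d₂ ∷ [])) Ws ((v , v∈ , h ∷ hs , fs) ∷ r)
    with ++⁻ H r | ∨-true⁻ {not (eval Ws α v)} h
  ... | rH , _ | inj₁ e = soundness d₁ Ws ((v , v∈ , hs , not-true⁻ e ∷ fs) ∷ rH)
  ... | _ , rG | inj₂ e = soundness d₂ Ws ((v , v∈ , e ∷ hs , fs) ∷ rG)
  soundness (node (⊃right {α = α}) (d ∷ [])) Ws ((v , v∈ , hs , f ∷ fs) ∷ r) =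
    soundness d Ws ((v , v∈ , not-false⁻ (proj₁ (∨-false⁻ {not (eval Ws α v)} f)) ∷ hs
                            , proj₂ (∨-false⁻ {not (eval Ws α v)} f) ∷ fs) ∷ r)
  soundness (node (□left {α = α}) (d ∷ [])) Ws ((_ , _ , h□ ∷ [] , []) ∷ (v , v∈ , hs , fs) ∷ r) =
    soundness d Ws ((v , v∈ , all-true⁻ (eval Ws α) h□ v∈ ∷ hs , fs) ∷ r)
  soundness (node (□right {α}) (d ∷ [])) Ws ((_ , _ , [] , f ∷ []) ∷ r) with all-false⁻ (eval Ws α) Ws f
  ... | w , w∈ , e = soundness d Ws ((w , w∈ , [] , e ∷ []) ∷ r)
  soundness (node (◇left {α}) (d ∷ [])) Ws ((_ , _ , h ∷ [] , []) ∷ r) with any-true⁻ (eval Ws α) Ws h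
  ... | w , w∈ , e = soundness d Ws ((w , w∈ , e ∷ [] , []) ∷ r)
  soundness (node (◇right {α = α}) (d ∷ [])) Ws ((v , v∈ , hs , fs) ∷ (_ , _ , [] , f◇ ∷ []) ∷ r) =
    soundness d Ws ((v , v∈ , hs , any-false⁻ (eval Ws α) f◇ v∈ ∷ fs) ∷ r)
  soundness (node ¬¬left (d ∷ [])) Ws ((v , v∈ , h ∷ hs , fs) ∷ r) =
    soundness d Ws ((v , v∈ , not-false⁻ (not-true⁻ h) ∷ hs , fs) ∷ r)
  soundness (node ¬¬right (d ∷ [])) Ws ((v , v∈ , hs , f ∷ fs) ∷ r) =
    soundness d Ws ((v , v∈ , hs , not-true⁻ (not-false⁻ f) ∷ fs) ∷ r)
  soundness (node (¬∧left {α = α} {H = H}) (d₁ ∷ d₂ ∷ [])) Ws ((v , v∈ , h ∷ hs , fs) ∷ r)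
    with ++⁻ H r | ∧-false⁻ {eval Ws α v} (not-true⁻ h)
  ... | rH , _ | inj₁ e = soundness d₁ Ws ((v , v∈ , hs , e ∷ fs) ∷ rH)
  ... | _ , rG | inj₂ e = soundness d₂ Ws ((v , v∈ , hs , e ∷ fs) ∷ rG)
  soundness (node (¬∧right {α = α}) (d ∷ [])) Ws ((v , v∈ , hs , f ∷ fs) ∷ r) =
    soundness d Ws ((v , v∈ , ∧-true⁻ˡ (not-false⁻ f) ∷ ∧-true⁻ʳ {eval Ws α v} (not-false⁻ f) ∷ hs , fs) ∷ r)
  soundness (node (¬∨left {α = α}) (d ∷ [])) Ws ((v , v∈ , h ∷ hs , fs) ∷ r) =
    soundness d Ws ((v , v∈ , hs , proj₁ (∨-false⁻ {eval Ws α v} (not-true⁻ h))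
                                 ∷ proj₂ (∨-false⁻ {eval Ws α v} (not-true⁻ h)) ∷ fs) ∷ r)
  soundness (node (¬∨right {α = α} {H = H}) (d₁ ∷ d₂ ∷ [])) Ws ((v , v∈ , hs , f ∷ fs) ∷ r)
    with ++⁻ H r | ∨-true⁻ {eval Ws α v} (not-false⁻ f)
  ... | rH , _ | inj₁ e = soundness d₁ Ws ((v , v∈ , e ∷ hs , fs) ∷ rH)
  ... | _ , rG | inj₂ e = soundness d₂ Ws ((v , v∈ , e ∷ hs , fs) ∷ rG)
  soundness (node (¬⊃left {α = α}) (d ∷ [])) Ws ((v , v∈ , h ∷ hs , fs) ∷ r) =
    soundness d Ws ((v , v∈ , not-false⁻ (proj₁ (∨-false⁻ {not (eval Ws α v)} (not-true⁻ h))) ∷ hs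
                            , proj₂ (∨-false⁻ {not (eval Ws α v)} (not-true⁻ h)) ∷ fs) ∷ r)
  soundness (node (¬⊃right {α = α} {H = H}) (d₁ ∷ d₂ ∷ [])) Ws ((v , v∈ , hs , f ∷ fs) ∷ r)
    with ++⁻ H r | ∨-true⁻ {not (eval Ws α v)} (not-false⁻ f)
  ... | rH , _ | inj₁ e = soundness d₁ Ws ((v , v∈ , hs , not-true⁻ e ∷ fs) ∷ rH)
  ... | _ , rG | inj₂ e = soundness d₂ Ws ((v , v∈ , e ∷ hs , fs) ∷ rG)
  soundness (node (¬□S5-left {α}) (d ∷ [])) Ws ((_ , _ , h ∷ [] , []) ∷ r) with all-false⁻ (eval Ws α) Ws (not-true⁻ h)
  ... | w , w∈ , e = soundness d Ws ((w , w∈ , [] , e ∷ []) ∷ r)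
  soundness (node (¬□S5-right {α = α}) (d ∷ [])) Ws ((v , v∈ , hs , fs) ∷ (_ , _ , [] , f ∷ []) ∷ r) =
    soundness d Ws ((v , v∈ , all-true⁻ (eval Ws α) (not-false⁻ f) v∈ ∷ hs , fs) ∷ r)
  soundness (node (¬◇S5-left {α = α}) (d ∷ [])) Ws ((_ , _ , h ∷ [] , []) ∷ (v , v∈ , hs , fs) ∷ r) =
    soundness d Ws ((v , v∈ , hs , any-false⁻ (eval Ws α) (not-true⁻ h) v∈ ∷ fs) ∷ r)
  soundness (node (¬◇S5-right {α}) (d ∷ [])) Ws ((_ , _ , [] , f ∷ []) ∷ r) with any-true⁻ (eval Ws α) Ws (not-false⁻ f)
  ... | w , w∈ , e = soundness d Ws ((w , w∈ , e ∷ [] , []) ∷ r)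

∈-hseqFmls⁺ : ∀ {H S φ} → S ∈ H → φ ∈ seqFmls S → φ ∈ hseqFmls H
∈-hseqFmls⁺ S∈H φ∈S = ∈-concatMap⁺ seqFmls (Any.map (λ { refl → φ∈S }) S∈H)

hseqFmls-mono : ∀ {H H'} → H ⊆ H' → hseqFmls H ⊆ hseqFmls H'
hseqFmls-mono = Subset.concatMap⁺ seqFmls

module HypersequentProofs where

  Provable : HSeq → Set
  Provable = Analytic HTS5 hseqFmls

  by-rule₀ : ∀ {c} → HTS5 [] c → Provable c
  by-rule₀ r = analytic-node r (λ ()) []

  by-rule₁ : ∀ {p c} → HTS5 [ p ] c → (∀ {φ} → φ ∈ hseqFmls p → φ ⊑* hseqFmls c) → Provable p → Provable c
  by-rule₁ r step d = analytic-node r (λ { (here refl) → step ; (there ()) }) (d ∷ [])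

  by-rule₂ : ∀ {p q c} → HTS5 (p ∷ q ∷ []) c → (∀ {φ} → φ ∈ hseqFmls p → φ ⊑* hseqFmls c) →
             (∀ {φ} → φ ∈ hseqFmls q → φ ⊑* hseqFmls c) → Provable p → Provable q → Provable c
  by-rule₂ r step₁ step₂ d₁ d₂ =
    analytic-node r (λ { (here refl) → step₁ ; (there (here refl)) → step₂ ; (there (there ())) }) (d₁ ∷ d₂ ∷ [])

  in-head : ∀ p c {K} → (∀ {φ} → φ ∈ seqFmls p → φ ⊑* hseqFmls (c ∷ K)) →
            ∀ {φ} → φ ∈ hseqFmls (p ∷ K) → φ ⊑* hseqFmls (c ∷ K)
  in-head p c step m with ∈-++⁻ (seqFmls p) m
  ... | inj₁ m' = step m'
  ... | inj₂ m' = ∈⇒⊑* (∈-++⁺ʳ (seqFmls c) m')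

  by-perm : ∀ {H H'} → H ↭ H' → Provable H → Provable H'
  by-perm H↭H' = by-rule₁ (perm H↭H') (∈⇒⊑* ∘ hseqFmls-mono (Subset.⊆-reflexive-↭ H↭H'))

  by-comp-eq : ∀ {Γ Γ' Δ Δ' K} → Γ ≋ Γ' → Δ ≋ Δ' → Provable ((Γ ⇒ Δ) ∷ K) → Provable ((Γ' ⇒ Δ') ∷ K)
  by-comp-eq {Γ} {Γ'} {Δ} {Δ'} {K} Γ≋Γ' Δ≋Δ' =
    by-rule₁ (comp-eq Γ≋Γ' Δ≋Δ') (in-head (Γ ⇒ Δ) (Γ' ⇒ Δ') {K} (∈⇒⊑* ∘ ∈-++⁺ˡ ∘ Subset.++⁺ (proj₁ Γ≋Γ') (proj₁ Δ≋Δ')))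

  by-merge : ∀ {Γ Δ Σ Π K} → Provable ((Γ ⇒ Δ) ∷ (Σ ⇒ Π) ∷ K) → Provable ((Γ ++ Σ ⇒ Δ ++ Π) ∷ K)
  by-merge {Γ} {Δ} {Σ} {Π} {K} = by-rule₁ merge (∈⇒⊑* ∘ merged)
    where
    merged : hseqFmls ((Γ ⇒ Δ) ∷ (Σ ⇒ Π) ∷ K) ⊆ hseqFmls ((Γ ++ Σ ⇒ Δ ++ Π) ∷ K)
    merged m with ∈-++⁻ (Γ ++ Δ) m
    ... | inj₁ m' with ∈-++⁻ Γ m'
    ...   | inj₁ φ∈Γ = ∈-++⁺ˡ (∈-++⁺ˡ (∈-++⁺ˡ φ∈Γ))
    ...   | inj₂ φ∈Δ = ∈-++⁺ˡ (∈-++⁺ʳ (Γ ++ Σ) (∈-++⁺ˡ φ∈Δ))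
    merged m | inj₂ m' with ∈-++⁻ (Σ ++ Π) m'
    ...   | inj₂ φ∈K = ∈-++⁺ʳ ((Γ ++ Σ) ++ (Δ ++ Π)) φ∈K
    ...   | inj₁ m'' with ∈-++⁻ Σ m''
    ...     | inj₁ φ∈Σ = ∈-++⁺ˡ (∈-++⁺ˡ (∈-++⁺ʳ Γ φ∈Σ))
    ...     | inj₂ φ∈Π = ∈-++⁺ˡ (∈-++⁺ʳ (Γ ++ Σ) (∈-++⁺ʳ Δ φ∈Π))

  absorb : ∀ {P S K} → Seq.ant P ⊆ Seq.ant S → Seq.suc P ⊆ Seq.suc S → S ∈ K → Provable (P ∷ K) → Provable K
  absorb {P} {S} Γ⊆Σ Δ⊆Π S∈K d with ∈-∃++ S∈K
  ... | A , B , refl =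
    by-perm (↭-sym (shift S A B))
      (by-comp-eq (⊆-absorbˡ Γ⊆Σ) (⊆-absorbˡ Δ⊆Π) (by-merge (by-perm (prep P (shift S A B)) d)))

  contract : ∀ K₂ {K₁} → K₂ ⊆ K₁ → Provable (K₁ ++ K₂) → Provable K₁
  contract [] {K₁} _ d rewrite ++-identityʳ K₁ = d
  contract (S ∷ K₂) {K₁} K₂⊆K₁ d =
    contract K₂ (K₂⊆K₁ ∘ there) (absorb id id (∈-++⁺ˡ (K₂⊆K₁ (here refl))) (by-perm (shift S K₁ K₂) d))

  weaken-headˡ : ∀ M {Γ Δ K} → Provable ((Γ ⇒ Δ) ∷ K) → Provable ((M ++ Γ ⇒ Δ) ∷ K)
  weaken-headˡ [] d = d
  weaken-headˡ (_ ∷ M) {Γ} {Δ} {K} d =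
    by-rule₁ in-we-left (in-head (M ++ Γ ⇒ Δ) (_ ∷ M ++ Γ ⇒ Δ) {K} (∈⇒⊑* ∘ ∈-++⁺ˡ ∘ there)) (weaken-headˡ M d)

  weaken-headʳ : ∀ M {Γ Δ K} → Provable ((Γ ⇒ Δ) ∷ K) → Provable ((Γ ⇒ M ++ Δ) ∷ K)
  weaken-headʳ [] d = d
  weaken-headʳ (_ ∷ M) {Γ} {Δ} {K} d =
    by-rule₁ in-we-right (in-head (Γ ⇒ M ++ Δ) (Γ ⇒ _ ∷ M ++ Δ) {K} (∈⇒⊑* ∘ ∈-++⁺ˡ ∘ Subset.++⁺ʳ Γ there)) (weaken-headʳ M d)

  weaken-head : ∀ {Γ Δ L R K} → Γ ⊆ L → Δ ⊆ R → Provable ((Γ ⇒ Δ) ∷ K) → Provable ((L ⇒ R) ∷ K)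
  weaken-head {L = L} {R} Γ⊆L Δ⊆R d =
    by-comp-eq (⊆-absorbʳ Γ⊆L) (⊆-absorbʳ Δ⊆R) (weaken-headˡ L (weaken-headʳ R d))

  -- New components are added by cutting on a formula φ already present, so the cut stays analytic.
  add-component : ∀ S {K φ} → φ ∈ hseqFmls K → Provable K → Provable (S ∷ K)
  add-component (Γ ⇒ Δ) {K} {φ} φ∈K d =
    by-comp-eq (++-identityʳ-≋ Γ) (++-identityʳ-≋ Δ) (weaken-headˡ Γ (weaken-headʳ Δ (contract K there cut-φ)))
    where
    ++-identityʳ-≋ : ∀ (X : List Fm) → X ++ [] ≋ X
    ++-identityʳ-≋ X rewrite ++-identityʳ X = id , id
    φ-left : Provable (([ φ ] ⇒ []) ∷ K)
    φ-left = by-rule₁ ex-we-left (∈⇒⊑* ∘ ∈-++⁺ʳ (φ ∷ [])) d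
    φ-right : Provable (([] ⇒ [ φ ]) ∷ K)
    φ-right = by-rule₁ ex-we-right (∈⇒⊑* ∘ ∈-++⁺ʳ (φ ∷ [])) d
    in-K++K : ∀ {ψ} → ψ ∈ φ ∷ hseqFmls K → ψ ⊑* hseqFmls (([] ⇒ []) ∷ K ++ K)
    in-K++K (here refl) = ∈⇒⊑* (hseqFmls-mono {K} {K ++ K} ∈-++⁺ˡ φ∈K)
    in-K++K (there ψ∈K) = ∈⇒⊑* (hseqFmls-mono {K} {K ++ K} ∈-++⁺ˡ ψ∈K)
    cut-φ : Provable (([] ⇒ []) ∷ K ++ K)
    cut-φ = by-rule₂ (cut {Γ = []} {Δ = []} {Σ = []} {Π = []} {α = φ} {H = K} {G = K}) in-K++K in-K++K φ-right φ-left

  add-components : ∀ M {K φ} → φ ∈ hseqFmls K → Provable K → Provable (M ++ K)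
  add-components [] φ∈K d = d
  add-components (S ∷ M) {K} φ∈K d =
    add-component S (hseqFmls-mono {K} {M ++ K} (∈-++⁺ʳ M) φ∈K) (add-components M φ∈K d)

  weaken-into : ∀ {Γ Δ H S φ} → S ∈ H → Γ ⊆ Seq.ant S → Δ ⊆ Seq.suc S → φ ∈ seqFmls S →
                Provable [ Γ ⇒ Δ ] → Provable H
  weaken-into {S = S} S∈H Γ⊆ Δ⊆ φ∈S d with ∈-∃++ S∈H
  ... | A , B , refl =
    by-perm (↭-trans (++-comm (A ++ B) [ S ]) (↭-sym (shift S A B)))
      (add-components (A ++ B) {[ S ]} (∈-++⁺ˡ φ∈S) (weaken-head Γ⊆ Δ⊆ d))

  by-modal-rule : ∀ {p c a x} → HTS5 [ p ] c → a ⊑ x → x ∈ hseqFmls c → hseqFmls p ⊆ a ∷ hseqFmls c →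
                  Provable p → Provable c
  by-modal-rule {c = c} {a} r a⊑x x∈c p⊆ = by-rule₁ r (premise ∘ p⊆)
    where
    premise : ∀ {φ} → φ ∈ a ∷ hseqFmls c → φ ⊑* hseqFmls c
    premise (here refl) = ⊑-⊑*-trans a⊑x (∈⇒⊑* x∈c)
    premise (there φ∈c) = ∈⇒⊑* φ∈c

  private
    to-front : ∀ {a} Γ Δ {Z} → (Γ ++ a ∷ Δ) ++ Z ⊆ a ∷ (Γ ++ Δ) ++ Z
    to-front {a} Γ Δ {Z} = Subset.++⁺ˡ Z (Subset.⊆-reflexive-↭ {A = Fm} (shift a Γ Δ))

  □left-step : ∀ {a Γ Δ K} → Provable ((a ∷ Γ ⇒ Δ) ∷ K) → Provable (([ □ a ] ⇒ []) ∷ (Γ ⇒ Δ) ∷ K)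
  □left-step {a} = by-modal-rule □left ⊑□ (here refl) (Subset.∷⁺ʳ a there)

  ¬◇left-step : ∀ {a Γ Δ K} → Provable ((Γ ⇒ a ∷ Δ) ∷ K) → Provable (([ ¬ ◇ a ] ⇒ []) ∷ (Γ ⇒ Δ) ∷ K)
  ¬◇left-step {a} {Γ} {Δ} {K} =
    by-modal-rule ¬◇S5-left (sf-¬ ⊑◇) (here refl) (λ m → Subset.∷⁺ʳ a there (to-front {a} Γ Δ {hseqFmls K} m))

  ◇right-step : ∀ {a Γ Δ K} → Provable ((Γ ⇒ a ∷ Δ) ∷ K) → Provable (([] ⇒ [ ◇ a ]) ∷ (Γ ⇒ Δ) ∷ K)
  ◇right-step {a} {Γ} {Δ} {K} =
    by-perm (swap _ _ ↭-refl)
    ∘ by-modal-rule ◇right ⊑◇ (∈-++⁺ʳ (Γ ++ Δ) (here refl))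
        (λ m → Subset.∷⁺ʳ a (Subset.++⁺ʳ (Γ ++ Δ) there) (to-front {a} Γ Δ {hseqFmls K} m))

  ¬□right-step : ∀ {a Γ Δ K} → Provable ((a ∷ Γ ⇒ Δ) ∷ K) → Provable (([] ⇒ [ ¬ □ a ]) ∷ (Γ ⇒ Δ) ∷ K)
  ¬□right-step {a} {Γ} {Δ} {K} =
    by-perm (swap _ _ ↭-refl)
    ∘ by-modal-rule ¬□S5-right (sf-¬ ⊑□) (∈-++⁺ʳ (Γ ++ Δ) (here refl))
        (Subset.∷⁺ʳ a (Subset.++⁺ʳ (Γ ++ Δ) (Subset.xs⊆x∷xs (hseqFmls K) (¬ □ a))))

  ◇left-step : ∀ {a K} → Provable (([ a ] ⇒ []) ∷ K) → Provable (([ ◇ a ] ⇒ []) ∷ K)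
  ◇left-step {a} = by-modal-rule ◇left ⊑◇ (here refl) (Subset.∷⁺ʳ a there)

  ¬□left-step : ∀ {a K} → Provable (([] ⇒ [ a ]) ∷ K) → Provable (([ ¬ □ a ] ⇒ []) ∷ K)
  ¬□left-step {a} = by-modal-rule ¬□S5-left (sf-¬ ⊑□) (here refl) (Subset.∷⁺ʳ a there)

  □right-step : ∀ {a K} → Provable (([] ⇒ [ a ]) ∷ K) → Provable (([] ⇒ [ □ a ]) ∷ K)
  □right-step {a} = by-modal-rule □right ⊑□ (here refl) (Subset.∷⁺ʳ a there)

  ¬◇right-step : ∀ {a K} → Provable (([ a ] ⇒ []) ∷ K) → Provable (([] ⇒ [ ¬ ◇ a ]) ∷ K)
  ¬◇right-step {a} = by-modal-rule ¬◇S5-right (sf-¬ ⊑◇) (here refl) (Subset.∷⁺ʳ a there)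

-- Proof search in HTS5

-- One copy of the side hypersequent per premise: the two-premise rules of HTS5 duplicate it.
copies : List Extension → HSeq → HSeq
copies [] K = K
copies (_ ∷ []) K = K
copies (_ ∷ e ∷ es) K = K ++ copies (e ∷ es) K

copies-⊆ : ∀ exts {K} → copies exts K ⊆ K
copies-⊆ [] = id
copies-⊆ (_ ∷ []) = id
copies-⊆ (_ ∷ e ∷ es) {K} = Sum.[ id , copies-⊆ (e ∷ es) ] ∘ ∈-++⁻ K

⊆-copies : ∀ exts {K} → K ⊆ copies exts K
⊆-copies [] = id
⊆-copies (_ ∷ []) = id
⊆-copies (_ ∷ _ ∷ _) = ∈-++⁺ˡ

hts5-leftRule : ∀ f {exts L R K} → leftPremises false f ≡ just exts →
                HTS5 (map (λ e → extend L R e ∷ K) exts) ((f ∷ L ⇒ R) ∷ copies exts K)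
hts5-leftRule (a ∧ b) refl = ∧left
hts5-leftRule (a ∨ b) refl = ∨left
hts5-leftRule (a ⊃ b) refl = ⊃left
hts5-leftRule (¬ ¬ a) refl = ¬¬left
hts5-leftRule (¬ (a ∧ b)) refl = ¬∧left
hts5-leftRule (¬ (a ∨ b)) refl = ¬∨left
hts5-leftRule (¬ (a ⊃ b)) refl = ¬⊃left
hts5-leftRule (var _) ()
hts5-leftRule (□ _) ()
hts5-leftRule (◇ _) ()
hts5-leftRule (¬ var _) ()
hts5-leftRule (¬ □ _) ()
hts5-leftRule (¬ ◇ _) ()

hts5-rightRule : ∀ f {exts L R K} → rightPremises false f ≡ just exts →
                 HTS5 (map (λ e → extend L R e ∷ K) exts) ((L ⇒ f ∷ R) ∷ copies exts K)
hts5-rightRule (a ∧ b) refl = ∧right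
hts5-rightRule (a ∨ b) refl = ∨right
hts5-rightRule (a ⊃ b) refl = ⊃right
hts5-rightRule (¬ ¬ a) refl = ¬¬right
hts5-rightRule (¬ (a ∧ b)) refl = ¬∧right
hts5-rightRule (¬ (a ∨ b)) refl = ¬∨right
hts5-rightRule (¬ (a ⊃ b)) refl = ¬⊃right
hts5-rightRule (var _) ()
hts5-rightRule (□ _) ()
hts5-rightRule (◇ _) ()
hts5-rightRule (¬ var _) ()
hts5-rightRule (¬ □ _) ()
hts5-rightRule (¬ ◇ _) ()

InSomeAntecedent InSomeSuccedent : HSeq → Fm → Set
InSomeAntecedent H a = Any (λ S → a ∈ Seq.ant S) H
InSomeSuccedent H a = Any (λ S → a ∈ Seq.suc S) H

GlobalLeft : HSeq → Fm → Set
GlobalLeft H (□ a) = All (λ S → a ∈ Seq.ant S) H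
GlobalLeft H (¬ ◇ a) = All (λ S → a ∈ Seq.suc S) H
GlobalLeft H (◇ a) = InSomeAntecedent H a
GlobalLeft H (¬ □ a) = InSomeSuccedent H a
GlobalLeft _ _ = ⊤

GlobalRight : HSeq → Fm → Set
GlobalRight H (◇ a) = All (λ S → a ∈ Seq.suc S) H
GlobalRight H (¬ □ a) = All (λ S → a ∈ Seq.ant S) H
GlobalRight H (□ a) = InSomeSuccedent H a
GlobalRight H (¬ ◇ a) = InSomeAntecedent H a
GlobalRight _ _ = ⊤

data LeftDemand (H : HSeq) : Fm → Set where
  □-propagation : ∀ {a S} → S ∈ H → a ∉ Seq.ant S → LeftDemand H (□ a)
  ¬◇-propagation : ∀ {a S} → S ∈ H → a ∉ Seq.suc S → LeftDemand H (¬ ◇ a)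
  ◇-witness : ∀ {a} → (InSomeAntecedent H a → ⊥) → LeftDemand H (◇ a)
  ¬□-witness : ∀ {a} → (InSomeSuccedent H a → ⊥) → LeftDemand H (¬ □ a)

data RightDemand (H : HSeq) : Fm → Set where
  ◇-propagation : ∀ {a S} → S ∈ H → a ∉ Seq.suc S → RightDemand H (◇ a)
  ¬□-propagation : ∀ {a S} → S ∈ H → a ∉ Seq.ant S → RightDemand H (¬ □ a)
  □-witness : ∀ {a} → (InSomeSuccedent H a → ⊥) → RightDemand H (□ a)
  ¬◇-witness : ∀ {a} → (InSomeAntecedent H a → ⊥) → RightDemand H (¬ ◇ a)

private
  all-or-missing : ∀ {P : Seq → Set} → (∀ S → Dec (P S)) → ∀ H → All P H ⊎ ∃[ S ] (S ∈ H × (P S → ⊥))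
  all-or-missing P? = all-or-any (toSum ∘ P?)

globalLeft? : ∀ H f → GlobalLeft H f ⊎ LeftDemand H f
globalLeft? H (□ a) with all-or-missing (λ S → a ∈? Seq.ant S) H
... | inj₁ all = inj₁ all
... | inj₂ (_ , S∈H , a∉) = inj₂ (□-propagation S∈H a∉)
globalLeft? H (¬ ◇ a) with all-or-missing (λ S → a ∈? Seq.suc S) H
... | inj₁ all = inj₁ all
... | inj₂ (_ , S∈H , a∉) = inj₂ (¬◇-propagation S∈H a∉)
globalLeft? H (◇ a) with any? (λ S → a ∈? Seq.ant S) H
... | yes some = inj₁ some
... | no none = inj₂ (◇-witness none)
globalLeft? H (¬ □ a) with any? (λ S → a ∈? Seq.suc S) H
... | yes some = inj₁ some
... | no none = inj₂ (¬□-witness none)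
globalLeft? H (var _) = inj₁ tt
globalLeft? H (_ ∧ _) = inj₁ tt
globalLeft? H (_ ∨ _) = inj₁ tt
globalLeft? H (_ ⊃ _) = inj₁ tt
globalLeft? H (¬ var _) = inj₁ tt
globalLeft? H (¬ (_ ∧ _)) = inj₁ tt
globalLeft? H (¬ (_ ∨ _)) = inj₁ tt
globalLeft? H (¬ (_ ⊃ _)) = inj₁ tt
globalLeft? H (¬ ¬ _) = inj₁ tt

globalRight? : ∀ H f → GlobalRight H f ⊎ RightDemand H f
globalRight? H (◇ a) with all-or-missing (λ S → a ∈? Seq.suc S) H
... | inj₁ all = inj₁ all
... | inj₂ (_ , S∈H , a∉) = inj₂ (◇-propagation S∈H a∉)
globalRight? H (¬ □ a) with all-or-missing (λ S → a ∈? Seq.ant S) H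
... | inj₁ all = inj₁ all
... | inj₂ (_ , S∈H , a∉) = inj₂ (¬□-propagation S∈H a∉)
globalRight? H (□ a) with any? (λ S → a ∈? Seq.suc S) H
... | yes some = inj₁ some
... | no none = inj₂ (□-witness none)
globalRight? H (¬ ◇ a) with any? (λ S → a ∈? Seq.ant S) H
... | yes some = inj₁ some
... | no none = inj₂ (¬◇-witness none)
globalRight? H (var _) = inj₁ tt
globalRight? H (_ ∧ _) = inj₁ tt
globalRight? H (_ ∨ _) = inj₁ tt
globalRight? H (_ ⊃ _) = inj₁ tt
globalRight? H (¬ var _) = inj₁ tt
globalRight? H (¬ (_ ∧ _)) = inj₁ tt
globalRight? H (¬ (_ ∨ _)) = inj₁ tt
globalRight? H (¬ (_ ⊃ _)) = inj₁ tt
globalRight? H (¬ ¬ _) = inj₁ tt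

record HintikkaIn (H : HSeq) (S : Seq) : Set where
  field
    saturated-left : All (λ f → Saturated (leftPremises false f) (Seq.ant S) (Seq.suc S)) (Seq.ant S)
    saturated-right : All (λ f → Saturated (rightPremises false f) (Seq.ant S) (Seq.suc S)) (Seq.suc S)
    unclosed : Closed (Seq.ant S) (Seq.suc S) → ⊥
    global-left : All (GlobalLeft H) (Seq.ant S)
    global-right : All (GlobalRight H) (Seq.suc S)

data Defect (H : HSeq) (S : Seq) : Set where
  unsaturated-left : ∀ {f} → f ∈ Seq.ant S →
                     (Saturated (leftPremises false f) (Seq.ant S) (Seq.suc S) → ⊥) → Defect H S
  unsaturated-right : ∀ {f} → f ∈ Seq.suc S →
                      (Saturated (rightPremises false f) (Seq.ant S) (Seq.suc S) → ⊥) → Defect H S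
  closed : Closed (Seq.ant S) (Seq.suc S) → Defect H S
  left-demand : ∀ {f} → f ∈ Seq.ant S → LeftDemand H f → Defect H S
  right-demand : ∀ {f} → f ∈ Seq.suc S → RightDemand H f → Defect H S

inspect : ∀ H S → HintikkaIn H S ⊎ Defect H S
inspect H (L ⇒ R)
  with all-or-any (λ f → toSum (saturated? (leftPremises false f) L R)) L
     | all-or-any (λ f → toSum (saturated? (rightPremises false f) L R)) R
     | closed? L R | all-or-any (globalLeft? H) L | all-or-any (globalRight? H) R
... | inj₂ (_ , f∈ , unsat) | _ | _ | _ | _ = inj₂ (unsaturated-left f∈ unsat)
... | inj₁ _ | inj₂ (_ , f∈ , unsat) | _ | _ | _ = inj₂ (unsaturated-right f∈ unsat)
... | inj₁ _ | inj₁ _ | yes c | _ | _ = inj₂ (closed c)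
... | inj₁ _ | inj₁ _ | no _ | inj₂ (_ , f∈ , demand) | _ = inj₂ (left-demand f∈ demand)
... | inj₁ _ | inj₁ _ | no _ | inj₁ _ | inj₂ (_ , f∈ , demand) = inj₂ (right-demand f∈ demand)
... | inj₁ satL | inj₁ satR | no unclosed | inj₁ globL | inj₁ globR = inj₁ (record
  { saturated-left = satL ; saturated-right = satR ; unclosed = unclosed ; global-left = globL ; global-right = globR })

module HypersequentSearch where
  open S5Models
  open HypersequentProofs

  Decision : HSeq → Set
  Decision H = Provable H ⊎ Σ (List Valuation) (λ Ws → Refutes Ws H)

  map-decision : ∀ {A B} → (Provable A → Provable B) → (∀ {Ws} → Refutes Ws A → Refutes Ws B) →
                 Decision A → Decision B
  map-decision f g = Sum.map f (λ (Ws , r) → Ws , g r)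

  refutes-at : ∀ H₁ {H₂ S S' Ws} → (∀ {v} → RefutesAt Ws v S' → RefutesAt Ws v S) →
               Refutes Ws (H₁ ++ S' ∷ H₂) → Refutes Ws (H₁ ++ S ∷ H₂)
  refutes-at [] f ((v , v∈ , r) ∷ rs) = (v , v∈ , f r) ∷ rs
  refutes-at (_ ∷ H₁) f (r ∷ rs) = r ∷ refutes-at H₁ f rs

  to-head : ∀ H₁ {H₂ S} → Provable (H₁ ++ S ∷ H₂) → Provable (S ∷ H₁ ++ H₂)
  to-head H₁ {H₂} {S} = by-perm (shift S H₁ H₂)

  from-head : ∀ H₁ {H₂ S} → Provable (S ∷ H₁ ++ H₂) → Provable (H₁ ++ S ∷ H₂)
  from-head H₁ {H₂} {S} = by-perm (↭-sym (shift S H₁ H₂))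

  contract-copies : ∀ exts {S K} → Provable (S ∷ copies exts K) → Provable (S ∷ K)
  contract-copies [] = id
  contract-copies (_ ∷ []) = id
  contract-copies (_ ∷ e ∷ es) {S} {K} = contract (copies (e ∷ es) K) {S ∷ K} (there ∘ copies-⊆ (e ∷ es))

  all-provable-or-refuted : ∀ H₁ H₂ {L R} exts → All (λ e → Decision (H₁ ++ extend L R e ∷ H₂)) exts →
                            All (λ e → Provable (extend L R e ∷ H₁ ++ H₂)) exts
                            ⊎ Σ (List Valuation) (λ Ws → Refutes Ws (H₁ ++ (L ⇒ R) ∷ H₂))
  all-provable-or-refuted H₁ H₂ [] [] = inj₁ []
  all-provable-or-refuted H₁ H₂ ((cs , ds) ∷ _) (inj₂ (Ws , r) ∷ _) =
    inj₂ (Ws , refutes-at H₁ (λ (hs , fs) → ++⁻ʳ cs hs , ++⁻ʳ ds fs) r)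
  all-provable-or-refuted H₁ H₂ (e ∷ exts) (inj₁ d ∷ ds) with all-provable-or-refuted H₁ H₂ exts ds
  ... | inj₁ ps = inj₁ (to-head H₁ d ∷ ps)
  ... | inj₂ refuted = inj₂ refuted

  extensions-⊑* : ∀ {f L R c K} exts → All (ExtensionBy f) exts → f ∈ seqFmls c → L ⊆ seqFmls c → R ⊆ seqFmls c →
                  AnalyticStep hseqFmls (map (λ e → extend L R e ∷ K) exts) (c ∷ copies exts K)
  extensions-⊑* {L = L} {R} {c} {K} exts bys f∈c L⊆c R⊆c p∈ m with ∈-map⁻ (λ e → extend L R e ∷ K) p∈
  ... | e , e∈exts , refl with ∈-++⁻ (seqFmls (extend L R e)) m
  ...   | inj₁ m' = ⊑*-mono ∈-++⁺ˡ (extension-⊑* e (All.lookup bys e∈exts) (∈⇒⊑* f∈c) (∈⇒⊑* ∘ L⊆c) (∈⇒⊑* ∘ R⊆c) m')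
  ...   | inj₂ m' = ∈⇒⊑* (∈-++⁺ʳ (seqFmls c) (hseqFmls-mono (⊆-copies exts) m'))

  Rule : Seq → List Fm → List Fm → List Extension → Set
  Rule c L R exts = ∀ {K} → HTS5 (map (λ e → extend L R e ∷ K) exts) (c ∷ copies exts K)

  apply-left : ∀ {f L R} H₁ H₂ exts → Rule (f ∷ L ⇒ R) L R exts → f ∈ L → All (ExtensionBy f) exts →
               All (λ e → Decision (H₁ ++ extend L R e ∷ H₂)) exts → Decision (H₁ ++ (L ⇒ R) ∷ H₂)
  apply-left {f} {L} {R} H₁ H₂ exts r f∈L bys ds with all-provable-or-refuted H₁ H₂ exts ds
  ... | inj₂ refuted = inj₂ refuted
  ... | inj₁ ps = inj₁ (from-head H₁ (by-comp-eq (∷-absorb f∈L) ≋-refl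
                                       (contract-copies exts (analytic-node r step (map⁺ ps)))))
    where
    step : AnalyticStep hseqFmls (map (λ e → extend L R e ∷ H₁ ++ H₂) exts)
                                 ((f ∷ L ⇒ R) ∷ copies exts (H₁ ++ H₂))
    step = extensions-⊑* {c = f ∷ L ⇒ R} {H₁ ++ H₂} exts bys (here refl) (there ∘ ∈-++⁺ˡ) (∈-++⁺ʳ (f ∷ L))

  apply-right : ∀ {f L R} H₁ H₂ exts → Rule (L ⇒ f ∷ R) L R exts → f ∈ R → All (ExtensionBy f) exts →
                All (λ e → Decision (H₁ ++ extend L R e ∷ H₂)) exts → Decision (H₁ ++ (L ⇒ R) ∷ H₂)
  apply-right {f} {L} {R} H₁ H₂ exts r f∈R bys ds with all-provable-or-refuted H₁ H₂ exts ds
  ... | inj₂ refuted = inj₂ refuted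
  ... | inj₁ ps = inj₁ (from-head H₁ (by-comp-eq ≋-refl (∷-absorb f∈R)
                                       (contract-copies exts (analytic-node r step (map⁺ ps)))))
    where
    step : AnalyticStep hseqFmls (map (λ e → extend L R e ∷ H₁ ++ H₂) exts)
                                 ((L ⇒ f ∷ R) ∷ copies exts (H₁ ++ H₂))
    step = extensions-⊑* {c = L ⇒ f ∷ R} {H₁ ++ H₂} exts bys (∈-++⁺ʳ L (here refl)) ∈-++⁺ˡ (∈-++⁺ʳ L ∘ there)

  Expansion : List Fm → HSeq → HSeq → List Fm → List Fm → Set
  Expansion X H₁ H₂ L R =
    ∀ {f} e → f ⊑* X → ExtensionBy f e → Progress L R e → Decision (H₁ ++ extend L R e ∷ H₂)

  decompose-left : ∀ {X} H₁ H₂ {L R} → Expansion X H₁ H₂ L R → ∀ {f} → f ∈ L → f ⊑* X →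
                   (Saturated (leftPremises false f) L R → ⊥) → Decision (H₁ ++ (L ⇒ R) ∷ H₂)
  decompose-left H₁ H₂ expand {f} f∈L f⊑*X unsat with leftPremises false f in eq
  ... | nothing = ⊥-elim (unsat tt)
  ... | just exts = apply-left H₁ H₂ exts (hts5-leftRule f eq) f∈L bys
                      (All.map (uncurry (expand _ f⊑*X)) (unsaturated-extensions unsat bys))
    where
    bys : All (ExtensionBy f) exts
    bys = leftPremises-⊑ false f eq

  decompose-right : ∀ {X} H₁ H₂ {L R} → Expansion X H₁ H₂ L R → ∀ {f} → f ∈ R → f ⊑* X →
                    (Saturated (rightPremises false f) L R → ⊥) → Decision (H₁ ++ (L ⇒ R) ∷ H₂)
  decompose-right H₁ H₂ expand {f} f∈R f⊑*X unsat with rightPremises false f in eq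
  ... | nothing = ⊥-elim (unsat tt)
  ... | just exts = apply-right H₁ H₂ exts (hts5-rightRule f eq) f∈R bys
                      (All.map (uncurry (expand _ f⊑*X)) (unsaturated-extensions unsat bys))
    where
    bys : All (ExtensionBy f) exts
    bys = rightPremises-⊑ false f eq

  closed⇒provable : ∀ {H L R} → (L ⇒ R) ∈ H → Closed L R → Provable H
  closed⇒provable S∈H (var-both l r) = weaken-into S∈H (∈-∷⁺ʳ l λ ()) (∈-∷⁺ʳ r λ ()) (∈-++⁺ˡ l) (by-rule₀ (init-1 _))
  closed⇒provable S∈H (neg-both l r) = weaken-into S∈H (∈-∷⁺ʳ l λ ()) (∈-∷⁺ʳ r λ ()) (∈-++⁺ˡ l) (by-rule₀ (init-2 _))
  closed⇒provable S∈H (clash-left l l') =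
    weaken-into S∈H (∈-∷⁺ʳ l' (∈-∷⁺ʳ l λ ())) (λ ()) (∈-++⁺ˡ l) (by-rule₀ (init-3 _))
  closed⇒provable {L = L} S∈H (clash-right r r') =
    weaken-into S∈H (λ ()) (∈-∷⁺ʳ r' (∈-∷⁺ʳ r λ ())) (∈-++⁺ʳ L r) (by-rule₀ (init-4 _))

  propagate : ∀ H₁ H₂ {d d' P S} → (∀ {K} → Provable (d' ∷ K) → Provable (P ∷ d ∷ K)) →
              Seq.ant P ⊆ Seq.ant S → Seq.suc P ⊆ Seq.suc S → S ∈ H₁ ++ d ∷ H₂ →
              Provable (H₁ ++ d' ∷ H₂) → Provable (H₁ ++ d ∷ H₂)
  propagate H₁ H₂ {d} {P = P} step P⊆S P⊆S' S∈H =
    absorb P⊆S P⊆S' S∈H ∘ by-perm (prep P (↭-sym (shift d H₁ H₂))) ∘ step ∘ to-head H₁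

  module Countermodel (H : HSeq) (hintikka : All (HintikkaIn H) H) where

    valuation : Seq → Valuation
    valuation S p = var p ∈ᵇ Seq.ant S || ¬ var p ∈ᵇ Seq.suc S

    Ws : List Valuation
    Ws = map valuation H

    every-world : ∀ {P : Valuation → Set} → (∀ {S} → S ∈ H → P (valuation S)) → ∀ {v} → v ∈ Ws → P v
    every-world {P} h = All.lookup (map⁺ {P = P} {f = valuation} (tabulate h))

    module _ {S} (S∈H : S ∈ H) where
      open HintikkaIn (All.lookup hintikka S∈H) public

    mutual
      true-left : ∀ f {S} → S ∈ H → f ∈ Seq.ant S → Holds Ws (valuation S) f
      true-left (var p) _ m = ∨-true⁺ (inj₁ (∈⇒∈ᵇ m))
      true-left (¬ var p) S∈H m =
        not-true⁺ (∨-false⁺ (∉⇒∉ᵇ (unclosed S∈H ∘ clash-left m)) (∉⇒∉ᵇ (unclosed S∈H ∘ neg-both m)))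
      true-left (a ∧ b) S∈H m with All.lookup (saturated-left S∈H) m
      ... | here (ab⊆L , _) = ∧-true⁺ (true-left a S∈H (ab⊆L (here refl))) (true-left b S∈H (ab⊆L (there (here refl))))
      true-left (a ∨ b) {S} S∈H m with All.lookup (saturated-left S∈H) m
      ... | here (a⊆L , _) = ∨-true⁺ (inj₁ (true-left a S∈H (a⊆L (here refl))))
      ... | there (here (b⊆L , _)) = ∨-true⁺ {eval Ws a (valuation S)} (inj₂ (true-left b S∈H (b⊆L (here refl))))
      true-left (a ⊃ b) {S} S∈H m with All.lookup (saturated-left S∈H) m
      ... | here (_ , a⊆R) = ∨-true⁺ (inj₁ (not-true⁺ (false-right a S∈H (a⊆R (here refl)))))
      ... | there (here (b⊆L , _)) = ∨-true⁺ {not (eval Ws a (valuation S))} (inj₂ (true-left b S∈H (b⊆L (here refl))))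
      true-left (¬ ¬ a) S∈H m with All.lookup (saturated-left S∈H) m
      ... | here (a⊆L , _) = not-true⁺ (not-false⁺ (true-left a S∈H (a⊆L (here refl))))
      true-left (¬ (a ∧ b)) {S} S∈H m with All.lookup (saturated-left S∈H) m
      ... | here (_ , a⊆R) = not-true⁺ (∧-false⁺ (inj₁ (false-right a S∈H (a⊆R (here refl)))))
      ... | there (here (_ , b⊆R)) = not-true⁺ (∧-false⁺ {eval Ws a (valuation S)} (inj₂ (false-right b S∈H (b⊆R (here refl)))))
      true-left (¬ (a ∨ b)) S∈H m with All.lookup (saturated-left S∈H) m
      ... | here (_ , ab⊆R) =
        not-true⁺ (∨-false⁺ (false-right a S∈H (ab⊆R (here refl))) (false-right b S∈H (ab⊆R (there (here refl)))))
      true-left (¬ (a ⊃ b)) S∈H m with All.lookup (saturated-left S∈H) m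
      ... | here (a⊆L , b⊆R) =
        not-true⁺ (∨-false⁺ (not-false⁺ (true-left a S∈H (a⊆L (here refl)))) (false-right b S∈H (b⊆R (here refl))))
      true-left (□ a) S∈H m =
        all-true⁺ (eval Ws a) Ws
          (every-world {λ v → Holds Ws v a} λ d∈H → true-left a d∈H (All.lookup (All.lookup (global-left S∈H) m) d∈H))
      true-left (◇ a) S∈H m with find (All.lookup (global-left S∈H) m)
      ... | _ , d∈H , a∈d = any-true⁺ (eval Ws a) (∈-map⁺ valuation d∈H) (true-left a d∈H a∈d)
      true-left (¬ □ a) S∈H m with find (All.lookup (global-left S∈H) m)
      ... | _ , d∈H , a∈d = not-true⁺ (all-false⁺ (eval Ws a) (∈-map⁺ valuation d∈H) (false-right a d∈H a∈d))
      true-left (¬ ◇ a) S∈H m =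
        not-true⁺ (any-false⁺ (eval Ws a) Ws
          (every-world {λ v → Fails Ws v a} λ d∈H → false-right a d∈H (All.lookup (All.lookup (global-left S∈H) m) d∈H)))

      false-right : ∀ f {S} → S ∈ H → f ∈ Seq.suc S → Fails Ws (valuation S) f
      false-right (var p) S∈H m =
        ∨-false⁺ (∉⇒∉ᵇ (λ l → unclosed S∈H (var-both l m))) (∉⇒∉ᵇ (λ r → unclosed S∈H (clash-right r m)))
      false-right (¬ var p) {S} S∈H m = not-false⁺ (∨-true⁺ {var p ∈ᵇ Seq.ant S} (inj₂ (∈⇒∈ᵇ m)))
      false-right (a ∧ b) {S} S∈H m with All.lookup (saturated-right S∈H) m
      ... | here (_ , a⊆R) = ∧-false⁺ (inj₁ (false-right a S∈H (a⊆R (here refl))))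
      ... | there (here (_ , b⊆R)) = ∧-false⁺ {eval Ws a (valuation S)} (inj₂ (false-right b S∈H (b⊆R (here refl))))
      false-right (a ∨ b) S∈H m with All.lookup (saturated-right S∈H) m
      ... | here (_ , ab⊆R) = ∨-false⁺ (false-right a S∈H (ab⊆R (here refl))) (false-right b S∈H (ab⊆R (there (here refl))))
      false-right (a ⊃ b) S∈H m with All.lookup (saturated-right S∈H) m
      ... | here (a⊆L , b⊆R) =
        ∨-false⁺ (not-false⁺ (true-left a S∈H (a⊆L (here refl)))) (false-right b S∈H (b⊆R (here refl)))
      false-right (¬ ¬ a) S∈H m with All.lookup (saturated-right S∈H) m
      ... | here (_ , a⊆R) = not-false⁺ (not-true⁺ (false-right a S∈H (a⊆R (here refl))))
      false-right (¬ (a ∧ b)) S∈H m with All.lookup (saturated-right S∈H) m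
      ... | here (ab⊆L , _) =
        not-false⁺ (∧-true⁺ (true-left a S∈H (ab⊆L (here refl))) (true-left b S∈H (ab⊆L (there (here refl)))))
      false-right (¬ (a ∨ b)) {S} S∈H m with All.lookup (saturated-right S∈H) m
      ... | here (a⊆L , _) = not-false⁺ (∨-true⁺ (inj₁ (true-left a S∈H (a⊆L (here refl)))))
      ... | there (here (b⊆L , _)) = not-false⁺ (∨-true⁺ {eval Ws a (valuation S)} (inj₂ (true-left b S∈H (b⊆L (here refl)))))
      false-right (¬ (a ⊃ b)) {S} S∈H m with All.lookup (saturated-right S∈H) m
      ... | here (_ , a⊆R) = not-false⁺ (∨-true⁺ (inj₁ (not-true⁺ (false-right a S∈H (a⊆R (here refl))))))
      ... | there (here (b⊆L , _)) =
        not-false⁺ (∨-true⁺ {not (eval Ws a (valuation S))} (inj₂ (true-left b S∈H (b⊆L (here refl)))))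
      false-right (◇ a) S∈H m =
        any-false⁺ (eval Ws a) Ws
          (every-world {λ v → Fails Ws v a} λ d∈H → false-right a d∈H (All.lookup (All.lookup (global-right S∈H) m) d∈H))
      false-right (□ a) S∈H m with find (All.lookup (global-right S∈H) m)
      ... | _ , d∈H , a∈d = all-false⁺ (eval Ws a) (∈-map⁺ valuation d∈H) (false-right a d∈H a∈d)
      false-right (¬ ◇ a) S∈H m with find (All.lookup (global-right S∈H) m)
      ... | _ , d∈H , a∈d = not-false⁺ (any-true⁺ (eval Ws a) (∈-map⁺ valuation d∈H) (true-left a d∈H a∈d))
      false-right (¬ □ a) S∈H m =
        not-false⁺ (all-true⁺ (eval Ws a) Ws
          (every-world {λ v → Holds Ws v a} λ d∈H → true-left a d∈H (All.lookup (All.lookup (global-right S∈H) m) d∈H)))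

    refutes : Refutes Ws H
    refutes = tabulate λ {S} S∈H → valuation S , ∈-map⁺ valuation S∈H
                                 , tabulate (true-left _ S∈H) , tabulate (false-right _ S∈H)

  module Search (X : List Fm) where

    U : List Fm
    U = concatMap subformulas X

    Invariant : HSeq → Set
    Invariant = All (λ S → All (_⊑* X) (seqFmls S))

    local-measure : HSeq → ℕ
    local-measure H = sum (map (λ S → measure U (Seq.ant S) (Seq.suc S)) H)

    in-some-antecedent? : ∀ H x → Dec (InSomeAntecedent H x)
    in-some-antecedent? H x = any? (λ S → x ∈? Seq.ant S) H

    in-some-succedent? : ∀ H x → Dec (InSomeSuccedent H x)
    in-some-succedent? H x = any? (λ S → x ∈? Seq.suc S) H

    -- decreases when a witness component is created, and never increases otherwise
    witness-measure : HSeq → ℕ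
    witness-measure H = unsatisfied (in-some-succedent? H) U + unsatisfied (in-some-antecedent? H) U

    Grows : HSeq → HSeq → Set
    Grows H H' = ∀ {S} → S ∈ H → ∃[ S' ] (S' ∈ H' × Seq.ant S ⊆ Seq.ant S' × Seq.suc S ⊆ Seq.suc S')

    grows-at : ∀ H₁ {H₂ S S'} → Seq.ant S ⊆ Seq.ant S' → Seq.suc S ⊆ Seq.suc S' →
               Grows (H₁ ++ S ∷ H₂) (H₁ ++ S' ∷ H₂)
    grows-at [] ant⊆ suc⊆ (here refl) = _ , here refl , ant⊆ , suc⊆
    grows-at [] ant⊆ suc⊆ (there m) = _ , there m , id , id
    grows-at (_ ∷ H₁) ant⊆ suc⊆ (here refl) = _ , here refl , id , id
    grows-at (_ ∷ H₁) ant⊆ suc⊆ (there m) with grows-at H₁ ant⊆ suc⊆ m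
    ... | S' , S'∈ , ant⊆' , suc⊆' = S' , there S'∈ , ant⊆' , suc⊆'

    grows-antecedent : ∀ {H H'} → Grows H H' → ∀ {a} → InSomeAntecedent H a → InSomeAntecedent H' a
    grows-antecedent grows a∈H with find a∈H
    ... | _ , S∈H , a∈S with grows S∈H
    ...   | _ , S'∈H' , ant⊆ , _ = lose S'∈H' (ant⊆ a∈S)

    grows-succedent : ∀ {H H'} → Grows H H' → ∀ {a} → InSomeSuccedent H a → InSomeSuccedent H' a
    grows-succedent grows a∈H with find a∈H
    ... | _ , S∈H , a∈S with grows S∈H
    ...   | _ , S'∈H' , _ , suc⊆ = lose S'∈H' (suc⊆ a∈S)

    witness-measure-mono : ∀ {H H'} → Grows H H' → witness-measure H' ≤ witness-measure H
    witness-measure-mono {H} {H'} grows =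
      +-mono-≤ (unsatisfied-mono (in-some-succedent? H) (in-some-succedent? H') (grows-succedent grows) U)
               (unsatisfied-mono (in-some-antecedent? H) (in-some-antecedent? H') (grows-antecedent grows) U)

    witness-decreases-ant : ∀ {H a} → a ∈ U → (InSomeAntecedent H a → ⊥) →
                            witness-measure (([ a ] ⇒ []) ∷ H) < witness-measure H
    witness-decreases-ant {H} {a} a∈U none =
      +-mono-≤-< (unsatisfied-mono (in-some-succedent? H) (in-some-succedent? (_ ∷ H)) there U)
                 (unsatisfied-mono-< (in-some-antecedent? H) (in-some-antecedent? (([ a ] ⇒ []) ∷ H)) there
                                     U a∈U none (here (here refl)))

    witness-decreases-suc : ∀ {H a} → a ∈ U → (InSomeSuccedent H a → ⊥) →
                            witness-measure (([] ⇒ [ a ]) ∷ H) < witness-measure H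
    witness-decreases-suc {H} {a} a∈U none =
      +-mono-<-≤ (unsatisfied-mono-< (in-some-succedent? H) (in-some-succedent? (([] ⇒ [ a ]) ∷ H)) there
                                     U a∈U none (here (here refl)))
                 (unsatisfied-mono (in-some-antecedent? H) (in-some-antecedent? (_ ∷ H)) there U)

    local-measure-at : ∀ H₁ {H₂ S S'} → measure U (Seq.ant S') (Seq.suc S') < measure U (Seq.ant S) (Seq.suc S) →
                       local-measure (H₁ ++ S' ∷ H₂) < local-measure (H₁ ++ S ∷ H₂)
    local-measure-at [] {H₂} lt = +-monoˡ-< (local-measure H₂) lt
    local-measure-at (S ∷ H₁) lt = +-monoʳ-< (measure U (Seq.ant S) (Seq.suc S)) (local-measure-at H₁ lt)

    invariant-at : ∀ H₁ {H₂ S S'} → All (_⊑* X) (seqFmls S') → Invariant (H₁ ++ S ∷ H₂) →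
                   Invariant (H₁ ++ S' ∷ H₂)
    invariant-at [] new (_ ∷ inv) = new ∷ inv
    invariant-at (_ ∷ H₁) new (i ∷ inv) = i ∷ invariant-at H₁ new inv

    component-⊑* : ∀ {H S} → Invariant H → S ∈ H → ∀ {φ} → φ ∈ seqFmls S → φ ⊑* X
    component-⊑* inv S∈H = All.lookup (All.lookup inv S∈H)

    mutual
      solve : ∀ w k H → Invariant H → witness-measure H ≤ w → local-measure H < k → Decision H
      solve w zero H inv w≤ ()
      solve w (suc k) H inv w≤ l< with all-or-any (inspect H) H
      ... | inj₁ hintikka = inj₂ (Countermodel.Ws H hintikka , Countermodel.refutes H hintikka)
      ... | inj₂ (_ , S∈H , defect) = repair w k H inv w≤ (≤-pred l<) S∈H defect

      repair : ∀ w k H → Invariant H → witness-measure H ≤ w → local-measure H ≤ k →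
               ∀ {S} → S ∈ H → Defect H S → Decision H
      repair w k H inv w≤ l≤ S∈H (closed c) = inj₁ (closed⇒provable S∈H c)
      repair w k H inv w≤ l≤ S∈H (unsaturated-left f∈ unsat) with ∈-∃++ S∈H
      ... | H₁ , H₂ , refl =
        decompose-left H₁ H₂ (expand w k H₁ H₂ inv w≤ l≤) f∈ (component-⊑* inv S∈H (∈-++⁺ˡ f∈)) unsat
      repair w k H inv w≤ l≤ {L ⇒ R} S∈H (unsaturated-right f∈ unsat) with ∈-∃++ S∈H
      ... | H₁ , H₂ , refl =
        decompose-right H₁ H₂ (expand w k H₁ H₂ inv w≤ l≤) f∈ (component-⊑* inv S∈H (∈-++⁺ʳ L f∈)) unsat
      repair w k H inv w≤ l≤ S∈H (left-demand f∈ demand) =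
        meet-left w k H inv w≤ l≤ S∈H f∈ (component-⊑* inv S∈H (∈-++⁺ˡ f∈)) demand
      repair w k H inv w≤ l≤ {L ⇒ R} S∈H (right-demand f∈ demand) =
        meet-right w k H inv w≤ l≤ S∈H f∈ (component-⊑* inv S∈H (∈-++⁺ʳ L f∈)) demand

      meet-left : ∀ w k H → Invariant H → witness-measure H ≤ w → local-measure H ≤ k →
                  ∀ {S f} → S ∈ H → f ∈ Seq.ant S → f ⊑* X → LeftDemand H f → Decision H
      meet-left w k H inv w≤ l≤ S∈H f∈ f⊑X (□-propagation {a} d∈H a∉) with ∈-∃++ d∈H
      ... | H₁ , H₂ , refl =
        map-decision (propagate H₁ H₂ □left-step (∈-∷⁺ʳ f∈ λ ()) (λ ()) S∈H)
          (refutes-at H₁ λ (hs , fs) → All.tail hs , fs)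
          (expand w k H₁ H₂ inv w≤ l≤ ([ a ] , []) f⊑X (⊑□ ∷ [] , []) (inj₁ (a , here refl , a∉)))
      meet-left w k H inv w≤ l≤ S∈H f∈ f⊑X (¬◇-propagation {a} d∈H a∉) with ∈-∃++ d∈H
      ... | H₁ , H₂ , refl =
        map-decision (propagate H₁ H₂ ¬◇left-step (∈-∷⁺ʳ f∈ λ ()) (λ ()) S∈H)
          (refutes-at H₁ λ (hs , fs) → hs , All.tail fs)
          (expand w k H₁ H₂ inv w≤ l≤ ([] , [ a ]) f⊑X ([] , sf-¬ ⊑◇ ∷ []) (inj₂ (a , here refl , a∉)))
      meet-left w k H inv w≤ l≤ S∈H f∈ f⊑X (◇-witness {a} none) =
        map-decision (absorb (∈-∷⁺ʳ f∈ λ ()) (λ ()) S∈H ∘ ◇left-step) All.tail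
          (restart w (([ a ] ⇒ []) ∷ H) ((a⊑X ∷ []) ∷ inv) (witness-decreases-ant (⊑*⇒∈subformulas a⊑X) none) w≤)
        where
        a⊑X : a ⊑* X
        a⊑X = ⊑-⊑*-trans ⊑◇ f⊑X
      meet-left w k H inv w≤ l≤ S∈H f∈ f⊑X (¬□-witness {a} none) =
        map-decision (absorb (∈-∷⁺ʳ f∈ λ ()) (λ ()) S∈H ∘ ¬□left-step) All.tail
          (restart w (([] ⇒ [ a ]) ∷ H) ((a⊑X ∷ []) ∷ inv) (witness-decreases-suc (⊑*⇒∈subformulas a⊑X) none) w≤)
        where
        a⊑X : a ⊑* X
        a⊑X = ⊑-⊑*-trans (sf-¬ ⊑□) f⊑X

      meet-right : ∀ w k H → Invariant H → witness-measure H ≤ w → local-measure H ≤ k →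
                   ∀ {S f} → S ∈ H → f ∈ Seq.suc S → f ⊑* X → RightDemand H f → Decision H
      meet-right w k H inv w≤ l≤ S∈H f∈ f⊑X (◇-propagation {a} d∈H a∉) with ∈-∃++ d∈H
      ... | H₁ , H₂ , refl =
        map-decision (propagate H₁ H₂ ◇right-step (λ ()) (∈-∷⁺ʳ f∈ λ ()) S∈H)
          (refutes-at H₁ λ (hs , fs) → hs , All.tail fs)
          (expand w k H₁ H₂ inv w≤ l≤ ([] , [ a ]) f⊑X ([] , ⊑◇ ∷ []) (inj₂ (a , here refl , a∉)))
      meet-right w k H inv w≤ l≤ S∈H f∈ f⊑X (¬□-propagation {a} d∈H a∉) with ∈-∃++ d∈H
      ... | H₁ , H₂ , refl =
        map-decision (propagate H₁ H₂ ¬□right-step (λ ()) (∈-∷⁺ʳ f∈ λ ()) S∈H)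
          (refutes-at H₁ λ (hs , fs) → All.tail hs , fs)
          (expand w k H₁ H₂ inv w≤ l≤ ([ a ] , []) f⊑X (sf-¬ ⊑□ ∷ [] , []) (inj₁ (a , here refl , a∉)))
      meet-right w k H inv w≤ l≤ S∈H f∈ f⊑X (□-witness {a} none) =
        map-decision (absorb (λ ()) (∈-∷⁺ʳ f∈ λ ()) S∈H ∘ □right-step) All.tail
          (restart w (([] ⇒ [ a ]) ∷ H) ((a⊑X ∷ []) ∷ inv) (witness-decreases-suc (⊑*⇒∈subformulas a⊑X) none) w≤)
        where
        a⊑X : a ⊑* X
        a⊑X = ⊑-⊑*-trans ⊑□ f⊑X
      meet-right w k H inv w≤ l≤ S∈H f∈ f⊑X (¬◇-witness {a} none) =
        map-decision (absorb (λ ()) (∈-∷⁺ʳ f∈ λ ()) S∈H ∘ ¬◇right-step) All.tail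
          (restart w (([ a ] ⇒ []) ∷ H) ((a⊑X ∷ []) ∷ inv) (witness-decreases-ant (⊑*⇒∈subformulas a⊑X) none) w≤)
        where
        a⊑X : a ⊑* X
        a⊑X = ⊑-⊑*-trans (sf-¬ ⊑◇) f⊑X

      expand : ∀ w k H₁ H₂ {L R} → Invariant (H₁ ++ (L ⇒ R) ∷ H₂) → witness-measure (H₁ ++ (L ⇒ R) ∷ H₂) ≤ w →
               local-measure (H₁ ++ (L ⇒ R) ∷ H₂) ≤ k → Expansion X H₁ H₂ L R
      expand w k H₁ H₂ {L} {R} inv w≤ l≤ {f} (cs , ds) f⊑X by progress =
        solve w k (H₁ ++ (cs ++ L ⇒ ds ++ R) ∷ H₂)
          (invariant-at H₁ (tabulate (extension-⊑* (cs , ds) by f⊑X (old ∘ ∈-++⁺ˡ) (old ∘ ∈-++⁺ʳ L))) inv)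
          (≤-trans (witness-measure-mono (grows-at H₁ (∈-++⁺ʳ cs) (∈-++⁺ʳ ds))) w≤)
          (<-≤-trans (local-measure-at H₁ (measure-decreases U (in-U (proj₁ by)) (in-U (proj₂ by)) progress)) l≤)
        where
        old : ∀ {φ} → φ ∈ L ++ R → φ ⊑* X
        old = component-⊑* inv (∈-++⁺ʳ H₁ (here refl))
        in-U : ∀ {xs} → All (_⊑ f) xs → xs ⊆ U
        in-U xs⊑f x∈ = ⊑*⇒∈subformulas (⊑-⊑*-trans (All.lookup xs⊑f x∈) f⊑X)

      restart : ∀ w H' → Invariant H' → ∀ {H} → witness-measure H' < witness-measure H → witness-measure H ≤ w →
                Decision H'
      restart zero H' inv lt w≤ = ⊥-elim (n≮0 (<-≤-trans lt w≤))
      restart (suc w) H' inv lt w≤ = solve w (suc (local-measure H')) H' inv (≤-pred (<-≤-trans lt w≤)) ≤-refl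

  provable : ∀ {H} → Deriv HTS5 H → Decision H → Provable H
  provable d (inj₁ p) = p
  provable d (inj₂ (Ws , refuted)) = ⊥-elim (soundness d Ws refuted)

  complete : ∀ H → Deriv HTS5 H → Provable H
  complete H d = provable d (solve (witness-measure H) (suc (local-measure H)) H initial ≤-refl ≤-refl)
    where
    open Search (hseqFmls H)
    initial : Invariant H
    initial = tabulate λ S∈H → tabulate (∈⇒⊑* ∘ ∈-hseqFmls⁺ S∈H)

theorem5p5 : SubformulaProperty gTK seqFmls
           × SubformulaProperty gTKT seqFmls
           × SubformulaProperty HTS5 hseqFmls
theorem5p5 = SequentSearch.complete false , SequentSearch.complete true , HypersequentSearch.complete
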